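{- For every $A>0$ there is $B>0$ such that the following holds. Let $n\ge1$, $\epsilon\ge0$, and let $\mathcal{C}\subseteq[n]^2$ satisfy $|\mathcal{C}|\le An$ with at most $A\epsilon n^2$ unordered pairs of non-disjoint cosets in $\mathcal{C}$; let $h=\sum_{(i,j)\in\mathcal{C}}x_{i,j}$. Then for every $\delta>0$ with $\delta\ge\sqrt{\epsilon}$, either $\Pr[h\neq0]\le B\delta$ and $\mathbb{E}[h^2]\le B\delta$, or there exists a dictator $H$ with $\Pr[h\neq H]\le B\epsilon/\delta$ and $\mathbb{E}[(h-H)^2]\le B\epsilon/\delta$.
   Context: $S_n$ is the symmetric group on $[n]$; expectations and probabilities are over uniformly random $\pi\in S_n$. $x_{i,j}(\pi)=1$ if $\pi(i)=j$ and $0$ otherwise. The coset $(i,j)$ is $\{\pi:\pi(i)=j\}$; two distinct cosets $(i,j),(k,\ell)$ are non-disjoint iff $i\neq k$ and $j\neq\ell$. A dictator is a function of the form $\sum_{(i,j)\in\mathcal{D}}x_{i,j}$ where all elements of $\mathcal{D}\subseteq[n]^2$ share the same first coordinate or all share the same second coordinate.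
   Formalization: The parameters A, ε and δ range over ℚ, and the constant B is taken in ℚ as well. -}

module Defs where

open import Data.Bool using (Bool; true; false; _∧_; _∨_; not; if_then_else_)
open import Data.Nat as ℕ using (ℕ; zero; suc; _!)
open import Data.Nat.Properties using (_!≢0)
open import Data.Fin using (Fin; toℕ)
open import Data.Fin.Properties using (_≟_)
open import Data.List using (List; []; _∷_; [_]; map; concatMap; filter; foldr; allFin)
open import Data.Vec using (Vec; lookup) renaming ([] to []ᵥ; _∷_ to _∷ᵥ_)
open import Data.Product using (_×_; _,_; Σ; ∃)
open import Data.Sum using (_⊎_)
open import Data.Integer using (+_)
open import Data.Rational using (ℚ; 0ℚ; 1ℚ; _+_; _*_; _-_; _/_)
open import Relation.Nullary.Decidable using (⌊_⌋)
open import Relation.Binary.PropositionalEquality using (_≡_)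

Cosets : ℕ → Set
Cosets n = Fin n → Fin n → Bool

allPairs : (n : ℕ) → List (Fin n × Fin n)
allPairs n = concatMap (λ i → map (λ j → (i , j)) (allFin n)) (allFin n)

_≟ᵇ_ : ∀ {n} → Fin n → Fin n → Bool
i ≟ᵇ j = ⌊ i ≟ j ⌋

sumℚ : ∀ {A : Set} → List A → (A → ℚ) → ℚ
sumℚ xs f = foldr (λ a s → f a + s) 0ℚ xs

countB : ∀ {A : Set} → List A → (A → Bool) → ℕ
countB [] p = 0
countB (x ∷ xs) p = if p x then suc (countB xs p) else countB xs p

ℕ→ℚ : ℕ → ℚ
ℕ→ℚ k = (+ k) / 1

card : ∀ {n} → Cosets n → ℕ
card {n} C = countB (allPairs n) (λ { (i , j) → C i j })

-- two distinct cosets (i,j),(k,l) are non-disjoint iff i ≠ k and j ≠ l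
nonDisjoint : ∀ {n} → Fin n × Fin n → Fin n × Fin n → Bool
nonDisjoint (i , j) (k , l) = not (i ≟ᵇ k) ∧ not (j ≟ᵇ l)

-- a code for (i , j), used to count each unordered pair once
code : ∀ {n} → Fin n × Fin n → ℕ
code {n} (i , j) = toℕ i ℕ.* n ℕ.+ toℕ j

nonDisjointPairs : ∀ {n} → Cosets n → ℕ
nonDisjointPairs {n} C =
  countB (concatMap (λ c → map (λ d → (c , d)) (allPairs n)) (allPairs n))
    (λ { ((i , j) , (k , l)) →
         C i j ∧ C k l ∧ (code (i , j) ℕ.<ᵇ code (k , l)) ∧ nonDisjoint (i , j) (k , l) })

allVecs : (k n : ℕ) → List (Vec (Fin n) k)
allVecs zero n = [ []ᵥ ]
allVecs (suc k) n = concatMap (λ v → map (λ a → a ∷ᵥ v) (allFin n)) (allVecs k n)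

isInjective : ∀ {n} → (Fin n → Fin n) → Bool
isInjective {n} f =
  foldr _∧_ true (map (λ { (i , j) → (i ≟ᵇ j) ∨ not (f i ≟ᵇ f j) }) (allPairs n))

Sym : (n : ℕ) → List (Fin n → Fin n)
Sym n = map lookup (filter (λ v → isInjective (lookup v) Data.Bool.≟ true) (allVecs n n))
  where import Data.Bool

-- expectation over a uniformly random π ∈ S_n  (|S_n| = n!)
𝔼 : (n : ℕ) → ((Fin n → Fin n) → ℚ) → ℚ
𝔼 n f = sumℚ (Sym n) f * ((+ 1) / (n !)) {{n !≢0}}

Pr : (n : ℕ) → ((Fin n → Fin n) → Bool) → ℚ
Pr n P = 𝔼 n (λ π → if P π then 1ℚ else 0ℚ)

x : ∀ {n} → Fin n → Fin n → (Fin n → Fin n) → ℕ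
x i j π = if π i ≟ᵇ j then 1 else 0

sumX : ∀ {n} → Cosets n → (Fin n → Fin n) → ℕ
sumX {n} C π = foldr ℕ._+_ 0
  (map (λ { (i , j) → if C i j then x i j π else 0 }) (allPairs n))

IsDictator : ∀ {n} → Cosets n → Set
IsDictator {n} D =
  (Σ (Fin n) λ a → ∀ i j → D i j ≡ true → i ≡ a) ⊎
  (Σ (Fin n) λ b → ∀ i j → D i j ≡ true → j ≡ b)

module Submission where

-- Write h = Σ_{c ∈ C} x_c and let P be the number of ordered pairs of non-disjoint cosets of C.
-- For a uniformly random permutation, 𝔼[x_c] = 1/n, 𝔼[x_c x_d] ≤ 2/n² when c and d are
-- non-disjoint, and 𝔼[x_c x_d] = 0 for distinct disjoint cosets; hence 𝔼[h] = |C|/n and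
-- 𝔼[h²] ≤ |C|/n + 2P/n², while P ≤ 2Aεn² ≤ 2Aδ²n² by hypothesis.
-- If |C| ≤ Kδn (K = 12A + 12), Markov's inequality and these bounds give the first alternative.
-- Otherwise take the cell b maximising the number of cosets of C in its row plus its column.
-- Any two cosets of C are non-disjoint or share a row or a column, so the heavier line L through
-- b satisfies |C|² + |C| ≤ P + 2|C|·|C ∩ L|; and a coset off L is disjoint from at most one coset
-- of L, so |C ∖ L|·|C ∩ L| ≤ P + |C ∖ L|. Since P is small against |C|², these force
-- |C ∖ L| ≤ (ε/δ)·n, and the dictator H = Σ_{C ∩ L} x_c works because h − H = Σ_{C ∖ L} x_c.

open import Defs

module Counting where

  open import Data.Bool using (Bool; true; false; _∧_; _∨_; not; T; if_then_else_)
  import Data.Bool as Bool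
  open import Data.Bool.Properties using (∧-conicalʳ)
  open import Data.Empty using (⊥-elim)
  open import Data.Fin using (Fin; toℕ; combine) renaming (zero to fzero; suc to fsuc)
  import Data.Fin.Properties as Finₚ
  import Data.Fin.Permutation as Permutation
  open import Data.List using (List; []; _∷_; map; concatMap; foldr; filter; allFin; _++_; length; tabulate)
  import Data.List.Properties as Listₚ
  open import Data.List.Extrema.Nat using (argmax; f[xs]≤f[argmax])
  open import Data.List.Relation.Unary.All using (All; []; _∷_)
  open import Data.Nat using (ℕ; zero; suc; pred; _+_; _*_; _∸_; _!; _≤_; _≤?_; _<ᵇ_; z≤n; s≤s)
  import Data.Nat.Properties as ℕ
  open import Data.Nat.Tactic.RingSolver using (solve-∀)
  open import Data.Product using (Σ; _×_; _,_; proj₁; proj₂)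
  open import Data.Sum using (_⊎_; inj₁; inj₂)
  open import Data.Vec using (Vec; lookup) renaming ([] to []ᵥ; _∷_ to _∷ᵥ_; map to mapᵥ)
  import Data.Vec.Properties as Vecₚ
  import Algebra.Properties.CommutativeMonoid.Sum as MonoidSum
  open import Function using (_∘_; id)
  open import Relation.Nullary using (yes; no; ¬_)
  open import Relation.Binary.Definitions using (tri<; tri≈; tri>)
  open import Relation.Binary.PropositionalEquality using (_≡_; refl; sym; trans; cong; cong₂; module ≡-Reasoning)

  𝟙 : Bool → ℕ
  𝟙 true = 1
  𝟙 false = 0

  𝟙-∧ : ∀ a b → 𝟙 (a ∧ b) ≡ 𝟙 a * 𝟙 b
  𝟙-∧ true b = sym (ℕ.+-identityʳ (𝟙 b))
  𝟙-∧ false b = refl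

  𝟙-idem : ∀ b → 𝟙 b * 𝟙 b ≡ 𝟙 b
  𝟙-idem true = refl
  𝟙-idem false = refl

  ∑ : ∀ {A : Set} → List A → (A → ℕ) → ℕ
  ∑ [] f = 0
  ∑ (x ∷ xs) f = f x + ∑ xs f

  module _ {A : Set} where

    ∑-cong : (xs : List A) {f g : A → ℕ} → (∀ x → f x ≡ g x) → ∑ xs f ≡ ∑ xs g
    ∑-cong [] f≗g = refl
    ∑-cong (x ∷ xs) f≗g = cong₂ _+_ (f≗g x) (∑-cong xs f≗g)

    ∑-mono : (xs : List A) {f g : A → ℕ} → (∀ x → f x ≤ g x) → ∑ xs f ≤ ∑ xs g
    ∑-mono [] f≤g = z≤n
    ∑-mono (x ∷ xs) f≤g = ℕ.+-mono-≤ (f≤g x) (∑-mono xs f≤g)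

    ∑-+ : (xs : List A) (f g : A → ℕ) → ∑ xs (λ x → f x + g x) ≡ ∑ xs f + ∑ xs g
    ∑-+ [] f g = refl
    ∑-+ (x ∷ xs) f g rewrite ∑-+ xs f g = interchange (f x) (g x) (∑ xs f) (∑ xs g)
      where
      interchange : ∀ a b c d → a + b + (c + d) ≡ a + c + (b + d)
      interchange = solve-∀

    ∑-*ˡ : (xs : List A) (k : ℕ) (f : A → ℕ) → ∑ xs (λ x → k * f x) ≡ k * ∑ xs f
    ∑-*ˡ [] k f = sym (ℕ.*-zeroʳ k)
    ∑-*ˡ (x ∷ xs) k f rewrite ∑-*ˡ xs k f = sym (ℕ.*-distribˡ-+ k (f x) _)

    ∑-*ʳ : (xs : List A) (f : A → ℕ) (k : ℕ) → ∑ xs f * k ≡ ∑ xs (λ x → f x * k)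
    ∑-*ʳ xs f k = trans (ℕ.*-comm _ k) (trans (sym (∑-*ˡ xs k f)) (∑-cong xs (λ x → ℕ.*-comm k (f x))))

    ∑-const : (xs : List A) (k : ℕ) → ∑ xs (λ _ → k) ≡ length xs * k
    ∑-const [] k = refl
    ∑-const (x ∷ xs) k rewrite ∑-const xs k = refl

    ∑-zero : (xs : List A) (f : A → ℕ) → (∀ x → f x ≡ 0) → ∑ xs f ≡ 0
    ∑-zero xs f f≗0 = trans (∑-cong xs f≗0) (trans (∑-const xs 0) (ℕ.*-zeroʳ (length xs)))

    ∑-++ : (xs ys : List A) (f : A → ℕ) → ∑ (xs ++ ys) f ≡ ∑ xs f + ∑ ys f
    ∑-++ [] ys f = refl
    ∑-++ (x ∷ xs) ys f rewrite ∑-++ xs ys f = sym (ℕ.+-assoc (f x) _ _)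

  module _ {A B : Set} where

    ∑-map : (g : A → B) (xs : List A) (f : B → ℕ) → ∑ (map g xs) f ≡ ∑ xs (f ∘ g)
    ∑-map g [] f = refl
    ∑-map g (x ∷ xs) f = cong (f (g x) +_) (∑-map g xs f)

    ∑-concatMap : (g : A → List B) (xs : List A) (f : B → ℕ) →
      ∑ (concatMap g xs) f ≡ ∑ xs (λ x → ∑ (g x) f)
    ∑-concatMap g [] f = refl
    ∑-concatMap g (x ∷ xs) f rewrite ∑-++ (g x) (concatMap g xs) f | ∑-concatMap g xs f = refl

    ∑-comm : (xs : List A) (ys : List B) (f : A → B → ℕ) →
      ∑ xs (λ a → ∑ ys (f a)) ≡ ∑ ys (λ b → ∑ xs (λ a → f a b))
    ∑-comm [] ys f = sym (∑-zero ys _ (λ _ → refl))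
    ∑-comm (x ∷ xs) ys f rewrite ∑-comm xs ys f = sym (∑-+ ys (f x) (λ b → ∑ xs (λ a → f a b)))

  countB≡∑ : ∀ {A : Set} (xs : List A) (p : A → Bool) → countB xs p ≡ ∑ xs (𝟙 ∘ p)
  countB≡∑ [] p = refl
  countB≡∑ (x ∷ xs) p with p x
  ... | true = cong suc (countB≡∑ xs p)
  ... | false = countB≡∑ xs p

  conjunction⇒∑-failures≡0 : ∀ {A : Set} (g : A → Bool) (xs : List A) (w : A → ℕ) →
    foldr _∧_ true (map g xs) ≡ true → ∑ xs (λ y → w y * 𝟙 (not (g y))) ≡ 0
  conjunction⇒∑-failures≡0 g [] w _ = refl
  conjunction⇒∑-failures≡0 g (y ∷ ys) w all-g with g y
  ... | true = trans (cong (_+ ∑ ys (λ y → w y * 𝟙 (not (g y)))) (ℕ.*-zeroʳ (w y))) (conjunction⇒∑-failures≡0 g ys w all-g)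

  foldr-+-map≡∑ : ∀ {A : Set} (xs : List A) (f : A → ℕ) → foldr _+_ 0 (map f xs) ≡ ∑ xs f
  foldr-+-map≡∑ [] f = refl
  foldr-+-map≡∑ (x ∷ xs) f = cong (f x +_) (foldr-+-map≡∑ xs f)

  module _ {n : ℕ} where

    ≟ᵇ-refl : (i : Fin n) → (i ≟ᵇ i) ≡ true
    ≟ᵇ-refl i with i Finₚ.≟ i
    ... | yes _ = refl
    ... | no i≢i = ⊥-elim (i≢i refl)

    ≟ᵇ⇒≡ : {i j : Fin n} → (i ≟ᵇ j) ≡ true → i ≡ j
    ≟ᵇ⇒≡ {i} {j} _ with i Finₚ.≟ j
    ... | yes i≡j = i≡j

    ≢⇒≟ᵇ-false : {i j : Fin n} → ¬ i ≡ j → (i ≟ᵇ j) ≡ false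
    ≢⇒≟ᵇ-false {i} {j} i≢j with i Finₚ.≟ j
    ... | yes i≡j = ⊥-elim (i≢j i≡j)
    ... | no _ = refl

    ≟ᵇ-sym : (i j : Fin n) → (i ≟ᵇ j) ≡ (j ≟ᵇ i)
    ≟ᵇ-sym i j with i Finₚ.≟ j
    ... | yes refl = sym (≟ᵇ-refl i)
    ... | no i≢j = sym (≢⇒≟ᵇ-false (i≢j ∘ sym))

    ≟ᵇ-view : (i j : Fin n) → ((i ≟ᵇ j) ≡ true × i ≡ j) ⊎ ((i ≟ᵇ j) ≡ false × ¬ i ≡ j)
    ≟ᵇ-view i j with i Finₚ.≟ j
    ... | yes i≡j = inj₁ (refl , i≡j)
    ... | no i≢j = inj₂ (refl , i≢j)

  ∑Fin : (n : ℕ) → (Fin n → ℕ) → ℕ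
  ∑Fin n = ∑ (allFin n)

  ∑Fin-suc : (n : ℕ) (f : Fin (suc n) → ℕ) → ∑Fin (suc n) f ≡ f fzero + ∑Fin n (f ∘ fsuc)
  ∑Fin-suc n f = cong (f fzero +_) (∑-tabulate n fsuc f)
    where
    ∑-tabulate : ∀ {A : Set} (n : ℕ) (g : Fin n → A) (h : A → ℕ) → ∑ (tabulate g) h ≡ ∑Fin n (h ∘ g)
    ∑-tabulate zero g h = refl
    ∑-tabulate (suc n) g h =
      cong (h (g fzero) +_) (trans (∑-tabulate n (g ∘ fsuc) h) (sym (∑-tabulate n fsuc (h ∘ g))))

  ∑Fin-const : (n k : ℕ) → ∑Fin n (λ _ → k) ≡ n * k
  ∑Fin-const n k = trans (∑-const (allFin n) k) (cong (_* k) (Listₚ.length-tabulate {n = n} id))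

  ∑Fin-δ : (n : ℕ) (b : Fin n) (g : Fin n → ℕ) → ∑Fin n (λ a → 𝟙 (a ≟ᵇ b) * g a) ≡ g b
  ∑Fin-δ (suc n) fzero g rewrite ∑Fin-suc n (λ a → 𝟙 (a ≟ᵇ fzero) * g a) =
    trans (cong₂ _+_ (ℕ.+-identityʳ (g fzero)) (∑-zero (allFin n) _ λ a → cong (λ z → 𝟙 z * g (fsuc a)) (≢⇒≟ᵇ-false {i = fsuc a} {fzero} λ ())))
          (ℕ.+-identityʳ _)
  ∑Fin-δ (suc n) (fsuc b) g rewrite ∑Fin-suc n (λ a → 𝟙 (a ≟ᵇ fsuc b) * g a) | ≢⇒≟ᵇ-false {i = fzero} {fsuc b} (λ ()) =
    trans (∑-cong (allFin n) λ a → cong (λ z → 𝟙 z * g (fsuc a)) (fsuc-≟ᵇ a)) (∑Fin-δ n b (g ∘ fsuc))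
    where
    fsuc-≟ᵇ : (a : Fin n) → (fsuc a ≟ᵇ fsuc b) ≡ (a ≟ᵇ b)
    fsuc-≟ᵇ a with ≟ᵇ-view a b
    ... | inj₁ (eq , refl) = trans (≟ᵇ-refl (fsuc a)) (sym eq)
    ... | inj₂ (eq , a≢b) = trans (≢⇒≟ᵇ-false (a≢b ∘ Finₚ.suc-injective)) (sym eq)

  ∑Fin-δ′ : (n : ℕ) (b : Fin n) (g : Fin n → ℕ) → ∑Fin n (λ a → 𝟙 (b ≟ᵇ a) * g a) ≡ g b
  ∑Fin-δ′ n b g = trans (∑-cong (allFin n) λ a → cong (λ z → 𝟙 z * g a) (≟ᵇ-sym b a)) (∑Fin-δ n b g)

  Involution : ∀ {n} → (Fin n → Fin n) → Set
  Involution τ = ∀ a → τ (τ a) ≡ a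

  ∑Fin-involution : (n : ℕ) (τ : Fin n → Fin n) → Involution τ → (f : Fin n → ℕ) →
    ∑Fin n (f ∘ τ) ≡ ∑Fin n f
  ∑Fin-involution n τ τ∘τ≗id f =
    trans (∑Fin≡sum (f ∘ τ)) (trans (sym (MonoidSum.sum-permute ℕ.+-0-commutativeMonoid f τ↔)) (sym (∑Fin≡sum f)))
    where
    τ↔ : Permutation.Permutation n n
    τ↔ = Permutation.permutation τ τ τ∘τ≗id τ∘τ≗id
    ∑Fin≡sum : ∀ {n} (f : Fin n → ℕ) → ∑Fin n f ≡ MonoidSum.sum ℕ.+-0-commutativeMonoid f
    ∑Fin≡sum {zero} f = refl
    ∑Fin≡sum {suc n} f = trans (∑Fin-suc n f) (cong (f fzero +_) (∑Fin≡sum (f ∘ fsuc)))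

  Cell : ℕ → Set
  Cell n = Fin n × Fin n

  ∑Cell : (n : ℕ) → (Cell n → ℕ) → ℕ
  ∑Cell n = ∑ (allPairs n)

  ∑Cell-split : (n : ℕ) (F : Cell n → ℕ) → ∑Cell n F ≡ ∑Fin n (λ i → ∑Fin n (λ j → F (i , j)))
  ∑Cell-split n F = trans (∑-concatMap _ (allFin n) F) (∑-cong (allFin n) λ i → ∑-map _ (allFin n) F)

  sameCell : ∀ {n} → Cell n → Cell n → Bool
  sameCell (i , j) (k , l) = (i ≟ᵇ k) ∧ (j ≟ᵇ l)

  ∑Cell-δ : (n : ℕ) (c : Cell n) (g : Cell n → ℕ) → ∑Cell n (λ d → 𝟙 (sameCell c d) * g d) ≡ g c
  ∑Cell-δ n (c₁ , c₂) g = begin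
    ∑Cell n (λ d → 𝟙 (sameCell (c₁ , c₂) d) * g d)                   ≡⟨ ∑Cell-split n _ ⟩
    ∑Fin n (λ i → ∑Fin n (λ j → 𝟙 ((c₁ ≟ᵇ i) ∧ (c₂ ≟ᵇ j)) * g (i , j))) ≡⟨ ∑-cong (allFin n) factor ⟩
    ∑Fin n (λ i → 𝟙 (c₁ ≟ᵇ i) * ∑Fin n (λ j → 𝟙 (c₂ ≟ᵇ j) * g (i , j))) ≡⟨ ∑Fin-δ′ n c₁ _ ⟩
    ∑Fin n (λ j → 𝟙 (c₂ ≟ᵇ j) * g (c₁ , j))                            ≡⟨ ∑Fin-δ′ n c₂ _ ⟩
    g (c₁ , c₂)                                                         ∎
    where
    open ≡-Reasoning
    factor : ∀ i → ∑Fin n (λ j → 𝟙 ((c₁ ≟ᵇ i) ∧ (c₂ ≟ᵇ j)) * g (i , j))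
                 ≡ 𝟙 (c₁ ≟ᵇ i) * ∑Fin n (λ j → 𝟙 (c₂ ≟ᵇ j) * g (i , j))
    factor i = trans (∑-cong (allFin n) λ j →
                        trans (cong (_* g (i , j)) (𝟙-∧ (c₁ ≟ᵇ i) (c₂ ≟ᵇ j))) (ℕ.*-assoc (𝟙 (c₁ ≟ᵇ i)) _ _))
                     (∑-*ˡ (allFin n) (𝟙 (c₁ ≟ᵇ i)) _)

  -- Weight the failures of g by the Kronecker delta at c.
  conjunction-at : ∀ {n} (g : Cell n → Bool) → foldr _∧_ true (map g (allPairs n)) ≡ true → ∀ c → g c ≡ true
  conjunction-at {n} g all-g c with g c in gc
  ... | true = refl
  ... | false with () ← trans (cong (𝟙 ∘ not) (sym gc)) (trans (sym (∑Cell-δ n c (𝟙 ∘ not ∘ g)))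
                               (conjunction⇒∑-failures≡0 g (allPairs n) (𝟙 ∘ sameCell c) all-g))

  involution-≟ᵇ : ∀ {n} (τ : Fin n → Fin n) → Involution τ → ∀ x y → (τ x ≟ᵇ τ y) ≡ (x ≟ᵇ y)
  involution-≟ᵇ τ τ² x y with ≟ᵇ-view x y
  ... | inj₁ (eq , refl) = trans (≟ᵇ-refl (τ x)) (sym eq)
  ... | inj₂ (eq , x≢y) = trans (≢⇒≟ᵇ-false λ τx≡τy → x≢y (trans (sym (τ² x)) (trans (cong τ τx≡τy) (τ² y)))) (sym eq)

  involution-≟ᵇ′ : ∀ {n} (τ : Fin n → Fin n) → Involution τ → ∀ x y → (τ x ≟ᵇ y) ≡ (x ≟ᵇ τ y)
  involution-≟ᵇ′ τ τ² x y = trans (cong (τ x ≟ᵇ_) (sym (τ² y))) (involution-≟ᵇ τ τ² x (τ y))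

  module _ {n : ℕ} where

    swap : Fin n → Fin n → Fin n → Fin n
    swap a b x = if x ≟ᵇ a then b else (if x ≟ᵇ b then a else x)

    swap-left : (a b : Fin n) → swap a b a ≡ b
    swap-left a b rewrite ≟ᵇ-refl a = refl

    swap-right : (a b : Fin n) → swap a b b ≡ a
    swap-right a b with ≟ᵇ-view b a
    ... | inj₁ (eq , b≡a) rewrite eq = b≡a
    ... | inj₂ (eq , _) rewrite eq | ≟ᵇ-refl b = refl

    swap-other : (a b x : Fin n) → ¬ x ≡ a → ¬ x ≡ b → swap a b x ≡ x
    swap-other a b x x≢a x≢b rewrite ≢⇒≟ᵇ-false x≢a | ≢⇒≟ᵇ-false x≢b = refl

    swap-involutive : (a b : Fin n) → Involution (swap a b)
    swap-involutive a b x with ≟ᵇ-view x a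
    ... | inj₁ (_ , refl) = trans (cong (swap a b) (swap-left a b)) (swap-right a b)
    ... | inj₂ (_ , x≢a) with ≟ᵇ-view x b
    ... | inj₁ (_ , refl) = trans (cong (swap a b) (swap-right a b)) (swap-left a b)
    ... | inj₂ (_ , x≢b) = trans (cong (swap a b) (swap-other a b x x≢a x≢b)) (swap-other a b x x≢a x≢b)

  isInjective⇒injective : ∀ {n} (f : Fin n → Fin n) → isInjective f ≡ true → ∀ i j → f i ≡ f j → i ≡ j
  isInjective⇒injective f inj i j fi≡fj
    with conjunction-at (λ { (i , j) → (i ≟ᵇ j) ∨ not (f i ≟ᵇ f j) }) inj (i , j) | ≟ᵇ-view i j
  ... | _ | inj₁ (_ , i≡j) = i≡j
  ... | at-ij | inj₂ (eq , _) rewrite eq | fi≡fj | ≟ᵇ-refl (f j) with () ← at-ij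

  foldr-∧-map-cong : ∀ {A : Set} {g h : A → Bool} (xs : List A) → (∀ x → g x ≡ h x) →
    foldr _∧_ true (map g xs) ≡ foldr _∧_ true (map h xs)
  foldr-∧-map-cong [] g≗h = refl
  foldr-∧-map-cong (x ∷ xs) g≗h = cong₂ _∧_ (g≗h x) (foldr-∧-map-cong xs g≗h)

  isInjective-involution-∘ : ∀ {n} (τ : Fin n → Fin n) → Involution τ → (f g : Fin n → Fin n) →
    (∀ i → g i ≡ τ (f i)) → isInjective g ≡ isInjective f
  isInjective-involution-∘ {n} τ τ² f g g≗τ∘f = foldr-∧-map-cong (allPairs n) λ { (i , j) →
    cong (λ z → (i ≟ᵇ j) ∨ not z) (trans (cong₂ _≟ᵇ_ (g≗τ∘f i) (g≗τ∘f j)) (involution-≟ᵇ τ τ² (f i) (f j))) }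

  ∑Vec : (k n : ℕ) → (Vec (Fin n) k → ℕ) → ℕ
  ∑Vec k n = ∑ (allVecs k n)

  ∑Vec-suc : (k n : ℕ) (F : Vec (Fin n) (suc k) → ℕ) →
    ∑Vec (suc k) n F ≡ ∑Vec k n (λ v → ∑Fin n (λ a → F (a ∷ᵥ v)))
  ∑Vec-suc k n F = trans (∑-concatMap _ (allVecs k n) F) (∑-cong (allVecs k n) λ v → ∑-map _ (allFin n) F)

  ∑Vec-involution : (k n : ℕ) (τ : Fin n → Fin n) → Involution τ → (F : Vec (Fin n) k → ℕ) →
    ∑Vec k n (F ∘ mapᵥ τ) ≡ ∑Vec k n F
  ∑Vec-involution zero n τ τ² F = refl
  ∑Vec-involution (suc k) n τ τ² F = begin
    ∑Vec (suc k) n (F ∘ mapᵥ τ)                            ≡⟨ ∑Vec-suc k n _ ⟩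
    ∑Vec k n (λ v → ∑Fin n (λ a → F (τ a ∷ᵥ mapᵥ τ v)))    ≡⟨ ∑-cong (allVecs k n) (λ v → ∑Fin-involution n τ τ² (λ a → F (a ∷ᵥ mapᵥ τ v))) ⟩
    ∑Vec k n (λ v → ∑Fin n (λ a → F (a ∷ᵥ mapᵥ τ v)))      ≡⟨ ∑Vec-involution k n τ τ² (λ w → ∑Fin n (λ a → F (a ∷ᵥ w))) ⟩
    ∑Vec k n (λ v → ∑Fin n (λ a → F (a ∷ᵥ v)))             ≡⟨ ∑Vec-suc k n F ⟨
    ∑Vec (suc k) n F                                        ∎
    where open ≡-Reasoning

  -- A permutation of [n] is encoded by the vector of its values.
  isPerm : ∀ {n} → Vec (Fin n) n → Bool
  isPerm v = isInjective (lookup v)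

  ∑Perm : (n : ℕ) → (Vec (Fin n) n → ℕ) → ℕ
  ∑Perm n F = ∑Vec n n (λ v → 𝟙 (isPerm v) * F v)

  ∑-Sym≡∑Perm : (n : ℕ) (g : (Fin n → Fin n) → ℕ) → ∑ (Sym n) g ≡ ∑Perm n (g ∘ lookup)
  ∑-Sym≡∑Perm n g = trans (∑-map lookup (filter (λ v → isPerm v Bool.≟ true) (allVecs n n)) g) (∑-filter (isInjective ∘ lookup) (allVecs n n))
    where
    ∑-filter : ∀ {A : Set} (p : A → Bool) (xs : List A) {h : A → ℕ} →
      ∑ (filter (λ v → p v Bool.≟ true) xs) h ≡ ∑ xs (λ v → 𝟙 (p v) * h v)
    ∑-filter p [] = refl
    ∑-filter p (x ∷ xs) {h} with p x
    ... | true = cong₂ _+_ (sym (ℕ.+-identityʳ (h x))) (∑-filter p xs)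
    ... | false = ∑-filter p xs

  ∑Perm-involution : (n : ℕ) (τ : Fin n → Fin n) → Involution τ → (F : Vec (Fin n) n → ℕ) →
    ∑Perm n (F ∘ mapᵥ τ) ≡ ∑Perm n F
  ∑Perm-involution n τ τ² F =
    trans (∑-cong (allVecs n n) λ v → cong (λ z → 𝟙 z * F (mapᵥ τ v)) (sym (isPerm-τ v)))
          (∑Vec-involution n n τ τ² (λ v → 𝟙 (isPerm v) * F v))
    where
    isPerm-τ : ∀ v → isPerm (mapᵥ τ v) ≡ isPerm v
    isPerm-τ v = isInjective-involution-∘ τ τ² (lookup v) (lookup (mapᵥ τ v)) (λ i → Vecₚ.lookup-map i τ v)

  ∑Perm-cong : (n : ℕ) {F G : Vec (Fin n) n → ℕ} → (∀ v → isPerm v ≡ true → F v ≡ G v) → ∑Perm n F ≡ ∑Perm n G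
  ∑Perm-cong n {F} {G} F≗G = ∑-cong (allVecs n n) pointwise
    where
    pointwise : ∀ v → 𝟙 (isPerm v) * F v ≡ 𝟙 (isPerm v) * G v
    pointwise v with isPerm v in perm
    ... | true = cong (_+ 0) (F≗G v perm)
    ... | false = refl

  ∑Perm-mono : (n : ℕ) {F G : Vec (Fin n) n → ℕ} → (∀ v → isPerm v ≡ true → F v ≤ G v) → ∑Perm n F ≤ ∑Perm n G
  ∑Perm-mono n {F} {G} F≤G = ∑-mono (allVecs n n) pointwise
    where
    pointwise : ∀ v → 𝟙 (isPerm v) * F v ≤ 𝟙 (isPerm v) * G v
    pointwise v with isPerm v in perm
    ... | true = ℕ.+-monoˡ-≤ 0 (F≤G v perm)
    ... | false = z≤n

  ∑Perm-zero : (n : ℕ) (F : Vec (Fin n) n → ℕ) → (∀ v → isPerm v ≡ true → F v ≡ 0) → ∑Perm n F ≡ 0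
  ∑Perm-zero n F F≗0 = trans (∑Perm-cong n F≗0) (∑-zero (allVecs n n) _ λ v → ℕ.*-zeroʳ (𝟙 (isPerm v)))

  ∑Perm-*ˡ : (n k : ℕ) (F : Vec (Fin n) n → ℕ) → ∑Perm n (λ v → k * F v) ≡ k * ∑Perm n F
  ∑Perm-*ˡ n k F = trans (∑-cong (allVecs n n) λ v → rearrange (𝟙 (isPerm v)) k (F v)) (∑-*ˡ (allVecs n n) k _)
    where
    rearrange : ∀ a k b → a * (k * b) ≡ k * (a * b)
    rearrange = solve-∀

  ∑Perm-∑ : ∀ {A : Set} (n : ℕ) (xs : List A) (F : A → Vec (Fin n) n → ℕ) →
    ∑Perm n (λ v → ∑ xs (λ y → F y v)) ≡ ∑ xs (λ y → ∑Perm n (F y))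
  ∑Perm-∑ n xs F = trans (∑-cong (allVecs n n) λ v → sym (∑-*ˡ xs (𝟙 (isPerm v)) (λ y → F y v)))
                         (∑-comm (allVecs n n) xs (λ v y → 𝟙 (isPerm v) * F y v))

  permCount : ℕ → ℕ
  permCount n = ∑Perm n (λ _ → 1)

  hits : (n : ℕ) → Fin n → Fin n → ℕ
  hits n i j = ∑Perm n (λ v → 𝟙 (lookup v i ≟ᵇ j))

  jointHits : (n : ℕ) → Fin n → Fin n → Fin n → Fin n → ℕ
  jointHits n i j k l = ∑Perm n (λ v → 𝟙 (lookup v i ≟ᵇ j) * 𝟙 (lookup v k ≟ᵇ l))

  ∑Fin-𝟙-≟ᵇ : ∀ {n} (x : Fin n) → ∑Fin n (λ j → 𝟙 (x ≟ᵇ j)) ≡ 1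
  ∑Fin-𝟙-≟ᵇ {n} x = trans (∑-cong (allFin n) λ j → sym (ℕ.*-identityʳ (𝟙 (x ≟ᵇ j)))) (∑Fin-δ′ n x (λ _ → 1))

  swap-≟ᵇ : ∀ {n} (a b x y : Fin n) → (swap a b x ≟ᵇ y) ≡ (x ≟ᵇ swap a b y)
  swap-≟ᵇ a b = involution-≟ᵇ′ (swap a b) (swap-involutive a b)

  -- Relabelling values by the transposition (j j′) is a bijection of S_n.
  hits-value-invariant : (n : ℕ) (i j j′ : Fin n) → hits n i j ≡ hits n i j′
  hits-value-invariant n i j j′ =
    trans (sym (∑Perm-involution n τ (swap-involutive j j′) _)) (∑Perm-cong n λ v _ → cong 𝟙 (begin
      lookup (mapᵥ τ v) i ≟ᵇ j  ≡⟨ cong (_≟ᵇ j) (Vecₚ.lookup-map i τ v) ⟩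
      τ (lookup v i) ≟ᵇ j       ≡⟨ swap-≟ᵇ j j′ (lookup v i) j ⟩
      lookup v i ≟ᵇ τ j         ≡⟨ cong (lookup v i ≟ᵇ_) (swap-left j j′) ⟩
      lookup v i ≟ᵇ j′          ∎))
    where
    open ≡-Reasoning
    τ : Fin n → Fin n
    τ = swap j j′

  hits*n≡permCount : (n : ℕ) (i j : Fin n) → hits n i j * n ≡ permCount n
  hits*n≡permCount n i j = begin
    hits n i j * n                                   ≡⟨ ℕ.*-comm (hits n i j) n ⟩
    n * hits n i j                                   ≡⟨ ∑Fin-const n (hits n i j) ⟨
    ∑Fin n (λ _ → hits n i j)                        ≡⟨ ∑-cong (allFin n) (hits-value-invariant n i j) ⟩
    ∑Fin n (λ j′ → hits n i j′)                      ≡⟨ ∑Perm-∑ n (allFin n) (λ j′ v → 𝟙 (lookup v i ≟ᵇ j′)) ⟨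
    ∑Perm n (λ v → ∑Fin n (λ j′ → 𝟙 (lookup v i ≟ᵇ j′))) ≡⟨ ∑Perm-cong n (λ v _ → ∑Fin-𝟙-≟ᵇ (lookup v i)) ⟩
    permCount n                                      ∎
    where open ≡-Reasoning

  𝟙-≟ᵇ-distinct-targets : ∀ {n} (x j l : Fin n) → ¬ j ≡ l → 𝟙 (x ≟ᵇ j) * 𝟙 (x ≟ᵇ l) ≡ 0
  𝟙-≟ᵇ-distinct-targets x j l j≢l with ≟ᵇ-view x j
  ... | inj₂ (eq , _) rewrite eq = refl
  ... | inj₁ (eq , refl) rewrite eq | ≢⇒≟ᵇ-false j≢l = refl

  𝟙-≟ᵇ-distinct-sources : ∀ {n} (v : Vec (Fin n) n) → isPerm v ≡ true → (i k j : Fin n) → ¬ i ≡ k →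
    𝟙 (lookup v i ≟ᵇ j) * 𝟙 (lookup v k ≟ᵇ j) ≡ 0
  𝟙-≟ᵇ-distinct-sources v perm i k j i≢k with ≟ᵇ-view (lookup v i) j | ≟ᵇ-view (lookup v k) j
  ... | inj₂ (eq , _) | _ rewrite eq = refl
  ... | inj₁ (eq , _) | inj₂ (eq′ , _) rewrite eq | eq′ = refl
  ... | inj₁ (_ , vi≡j) | inj₁ (_ , vk≡j) = ⊥-elim (i≢k (isInjective⇒injective (lookup v) perm i k (trans vi≡j (sym vk≡j))))

  jointHits-value-invariant : (n : ℕ) (i j k l l′ : Fin n) → ¬ j ≡ l → ¬ j ≡ l′ →
    jointHits n i j k l ≡ jointHits n i j k l′
  jointHits-value-invariant n i j k l l′ j≢l j≢l′ =
    trans (sym (∑Perm-involution n τ (swap-involutive l l′) _)) (∑Perm-cong n λ v _ →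
      cong₂ (λ a b → 𝟙 a * 𝟙 b)
        (trans (cong (_≟ᵇ j) (Vecₚ.lookup-map i τ v))
               (trans (swap-≟ᵇ l l′ (lookup v i) j) (cong (lookup v i ≟ᵇ_) (swap-other l l′ j j≢l j≢l′))))
        (trans (cong (_≟ᵇ l) (Vecₚ.lookup-map k τ v))
               (trans (swap-≟ᵇ l l′ (lookup v k) l) (cong (lookup v k ≟ᵇ_) (swap-left l l′)))))
    where
    τ : Fin n → Fin n
    τ = swap l l′

  -- Summing over the target l of k: the term l = j vanishes and the other n − 1 terms are equal.
  hits+jointHits≡n*jointHits : (n : ℕ) (i j k l : Fin n) → ¬ i ≡ k → ¬ j ≡ l →
    hits n i j + jointHits n i j k l ≡ n * jointHits n i j k l
  hits+jointHits≡n*jointHits n i j k l i≢k j≢l = begin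
    hits n i j + J                                                 ≡⟨ cong₂ _+_ (sym ∑-targets) (sym (∑Fin-δ n j (λ _ → J))) ⟩
    ∑Fin n (λ l′ → jointHits n i j k l′) + ∑Fin n (λ l′ → 𝟙 (l′ ≟ᵇ j) * J) ≡⟨ ∑-+ (allFin n) _ _ ⟨
    ∑Fin n (λ l′ → jointHits n i j k l′ + 𝟙 (l′ ≟ᵇ j) * J)         ≡⟨ ∑-cong (allFin n) each-target ⟩
    ∑Fin n (λ _ → J)                                               ≡⟨ ∑Fin-const n J ⟩
    n * J                                                          ∎
    where
    open ≡-Reasoning
    J : ℕ
    J = jointHits n i j k l
    ∑-targets : ∑Fin n (λ l′ → jointHits n i j k l′) ≡ hits n i j
    ∑-targets = trans (sym (∑Perm-∑ n (allFin n) (λ l′ v → 𝟙 (lookup v i ≟ᵇ j) * 𝟙 (lookup v k ≟ᵇ l′))))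
      (∑Perm-cong n λ v _ → trans (∑-*ˡ (allFin n) (𝟙 (lookup v i ≟ᵇ j)) _)
        (trans (cong (𝟙 (lookup v i ≟ᵇ j) *_) (∑Fin-𝟙-≟ᵇ (lookup v k))) (ℕ.*-identityʳ _)))
    each-target : ∀ l′ → jointHits n i j k l′ + 𝟙 (l′ ≟ᵇ j) * J ≡ J
    each-target l′ with ≟ᵇ-view l′ j
    ... | inj₁ (eq , refl) rewrite eq =
      trans (cong (_+ (J + 0)) (∑Perm-zero n _ λ v perm → 𝟙-≟ᵇ-distinct-sources v perm i k l′ i≢k)) (ℕ.+-identityʳ J)
    ... | inj₂ (eq , l′≢j) rewrite eq =
      trans (ℕ.+-identityʳ _) (sym (jointHits-value-invariant n i j k l l′ j≢l (l′≢j ∘ sym)))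

  two-distinct⇒2≤n : ∀ {n} (i k : Fin n) → ¬ i ≡ k → 2 ≤ n
  two-distinct⇒2≤n {suc zero} fzero fzero i≢k = ⊥-elim (i≢k refl)
  two-distinct⇒2≤n {suc (suc _)} _ _ _ = s≤s (s≤s z≤n)

  jointHits-bound : (n : ℕ) (i j k l : Fin n) → ¬ i ≡ k → ¬ j ≡ l →
    jointHits n i j k l * n * n ≤ 2 * permCount n
  jointHits-bound n i j k l i≢k j≢l = begin
    J * n * n       ≡⟨ cong (_* n) (ℕ.*-comm J n) ⟩
    n * J * n       ≤⟨ ℕ.*-monoˡ-≤ n nJ≤2h ⟩
    2 * h * n       ≡⟨ ℕ.*-assoc 2 h n ⟩
    2 * (h * n)     ≡⟨ cong (2 *_) (hits*n≡permCount n i j) ⟩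
    2 * permCount n ∎
    where
    open ℕ.≤-Reasoning
    J h : ℕ
    J = jointHits n i j k l
    h = hits n i j
    2≤n : 2 ≤ n
    2≤n = two-distinct⇒2≤n i k i≢k
    double : ∀ x → x + x ≡ 2 * x
    double = solve-∀
    nJ≤2h : n * J ≤ 2 * h
    nJ≤2h = ℕ.+-cancelʳ-≤ (2 * J) (n * J) (2 * h) (begin
      n * J + 2 * J   ≤⟨ ℕ.+-monoʳ-≤ (n * J) (ℕ.*-monoˡ-≤ J 2≤n) ⟩
      n * J + n * J   ≡⟨ double (n * J) ⟩
      2 * (n * J)     ≡⟨ cong (2 *_) (hits+jointHits≡n*jointHits n i j k l i≢k j≢l) ⟨
      2 * (h + J)     ≡⟨ ℕ.*-distribˡ-+ 2 h J ⟩
      2 * h + 2 * J   ∎)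

  elem : ∀ {m k} → Fin m → Vec (Fin m) k → Bool
  elem a []ᵥ = false
  elem a (b ∷ᵥ w) = (a ≟ᵇ b) ∨ elem a w

  distinct : ∀ {m k} → Vec (Fin m) k → Bool
  distinct []ᵥ = true
  distinct (b ∷ᵥ w) = not (elem b w) ∧ distinct w

  ∑-elem : ∀ {m k} (v : Vec (Fin m) k) → distinct v ≡ true → ∑Fin m (λ a → 𝟙 (elem a v)) ≡ k
  ∑-elem {m} []ᵥ _ = ∑-zero (allFin m) _ (λ _ → refl)
  ∑-elem {m} (b ∷ᵥ w) dist with elem b w in b∈w | distinct w in dist-w
  ... | false | true = begin
    ∑Fin m (λ a → 𝟙 ((a ≟ᵇ b) ∨ elem a w))          ≡⟨ ∑-cong (allFin m) split ⟩
    ∑Fin m (λ a → 𝟙 (a ≟ᵇ b) + 𝟙 (elem a w))         ≡⟨ ∑-+ (allFin m) _ _ ⟩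
    ∑Fin m (λ a → 𝟙 (a ≟ᵇ b)) + ∑Fin m (λ a → 𝟙 (elem a w)) ≡⟨ cong₂ _+_ single (∑-elem w dist-w) ⟩
    suc _                                            ∎
    where
    open ≡-Reasoning
    split : ∀ a → 𝟙 ((a ≟ᵇ b) ∨ elem a w) ≡ 𝟙 (a ≟ᵇ b) + 𝟙 (elem a w)
    split a with ≟ᵇ-view a b
    ... | inj₁ (eq , refl) rewrite eq | b∈w = refl
    ... | inj₂ (eq , _) rewrite eq = refl
    single : ∑Fin m (λ a → 𝟙 (a ≟ᵇ b)) ≡ 1
    single = trans (∑-cong (allFin m) λ a → sym (ℕ.*-identityʳ _)) (∑Fin-δ m b (λ _ → 1))

  ∑-not-elem : ∀ {m k} (v : Vec (Fin m) k) → distinct v ≡ true → ∑Fin m (λ a → 𝟙 (not (elem a v))) ≡ m ∸ k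
  ∑-not-elem {m} {k} v dist = trans (sym (ℕ.m+n∸n≡m outside k)) (cong (_∸ k) outside+k≡m)
    where
    outside : ℕ
    outside = ∑Fin m (λ a → 𝟙 (not (elem a v)))
    complement : ∀ a → 𝟙 (not (elem a v)) + 𝟙 (elem a v) ≡ 1
    complement a with elem a v
    ... | true = refl
    ... | false = refl
    outside+k≡m : outside + k ≡ m
    outside+k≡m = begin
      outside + k                                           ≡⟨ cong (outside +_) (∑-elem v dist) ⟨
      outside + ∑Fin m (λ a → 𝟙 (elem a v))                 ≡⟨ ∑-+ (allFin m) _ _ ⟨
      ∑Fin m (λ a → 𝟙 (not (elem a v)) + 𝟙 (elem a v))      ≡⟨ ∑-cong (allFin m) complement ⟩
      ∑Fin m (λ _ → 1)                                      ≡⟨ ∑Fin-const m 1 ⟩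
      m * 1                                                 ≡⟨ ℕ.*-identityʳ m ⟩
      m                                                     ∎
      where open ≡-Reasoning

  distinctCount : (k m : ℕ) → ℕ
  distinctCount k m = ∑Vec k m (𝟙 ∘ distinct)

  distinctCount-suc : (k m : ℕ) → distinctCount (suc k) m ≤ distinctCount k m * (m ∸ k)
  distinctCount-suc k m = begin
    distinctCount (suc k) m                                            ≡⟨ ∑Vec-suc k m _ ⟩
    ∑Vec k m (λ v → ∑Fin m (λ a → 𝟙 (not (elem a v) ∧ distinct v)))    ≡⟨ ∑-cong (allVecs k m) factor ⟩
    ∑Vec k m (λ v → 𝟙 (distinct v) * ∑Fin m (λ a → 𝟙 (not (elem a v)))) ≡⟨ ∑-cong (allVecs k m) fresh ⟩
    ∑Vec k m (λ v → 𝟙 (distinct v) * (m ∸ k))                          ≡⟨ ∑-*ʳ (allVecs k m) _ (m ∸ k) ⟨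
    distinctCount k m * (m ∸ k)                                        ∎
    where
    open ℕ.≤-Reasoning
    factor : ∀ v → ∑Fin m (λ a → 𝟙 (not (elem a v) ∧ distinct v)) ≡ 𝟙 (distinct v) * ∑Fin m (λ a → 𝟙 (not (elem a v)))
    factor v = trans (∑-cong (allFin m) λ a → trans (𝟙-∧ (not (elem a v)) (distinct v)) (ℕ.*-comm _ (𝟙 (distinct v))))
                     (∑-*ˡ (allFin m) (𝟙 (distinct v)) _)
    fresh : ∀ v → 𝟙 (distinct v) * ∑Fin m (λ a → 𝟙 (not (elem a v))) ≡ 𝟙 (distinct v) * (m ∸ k)
    fresh v with distinct v in dist
    ... | true = cong (_+ 0) (∑-not-elem v dist)
    ... | false = refl

  distinctCount-bound : (k m : ℕ) → distinctCount k m * (m ∸ k) ! ≤ m !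
  distinctCount-bound zero m = ℕ.≤-reflexive (ℕ.+-identityʳ (m !))
  distinctCount-bound (suc k) m with m ∸ k in m∸k
  ... | zero = ℕ.≤-trans (ℕ.*-monoˡ-≤ ((m ∸ suc k) !) no-room) z≤n
    where
    no-room : distinctCount (suc k) m ≤ 0
    no-room = ℕ.≤-trans (distinctCount-suc k m) (ℕ.≤-reflexive (trans (cong (distinctCount k m *_) m∸k) (ℕ.*-zeroʳ (distinctCount k m))))
  ... | suc t = begin
    distinctCount (suc k) m * (m ∸ suc k) !  ≤⟨ ℕ.*-monoˡ-≤ _ (distinctCount-suc k m) ⟩
    D * (m ∸ k) * (m ∸ suc k) !              ≡⟨ cong (λ z → D * z * (m ∸ suc k) !) m∸k ⟩
    D * suc t * (m ∸ suc k) !                ≡⟨ cong (λ z → D * suc t * z !) m∸1+k ⟩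
    D * suc t * t !                          ≡⟨ ℕ.*-assoc D (suc t) (t !) ⟩
    D * (suc t) !                            ≡⟨ cong (λ z → D * z !) m∸k ⟨
    D * (m ∸ k) !                            ≤⟨ distinctCount-bound k m ⟩
    m !                                      ∎
    where
    open ℕ.≤-Reasoning
    D : ℕ
    D = distinctCount k m
    m∸1+k : m ∸ suc k ≡ t
    m∸1+k = trans (sym (ℕ.pred[m∸n]≡m∸[1+n] m k)) (cong pred m∸k)

  elem⇒lookup : ∀ {m k} (b : Fin m) (w : Vec (Fin m) k) → elem b w ≡ true → Σ (Fin k) (λ i → lookup w i ≡ b)
  elem⇒lookup b (c ∷ᵥ w) b∈ with ≟ᵇ-view b c
  ... | inj₁ (_ , b≡c) = fzero , sym b≡c
  ... | inj₂ (eq , _) rewrite eq with elem⇒lookup b w b∈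
  ... | i , wi≡b = fsuc i , wi≡b

  injective⇒distinct : ∀ {m k} (v : Vec (Fin m) k) → (∀ i j → lookup v i ≡ lookup v j → i ≡ j) → distinct v ≡ true
  injective⇒distinct []ᵥ _ = refl
  injective⇒distinct (b ∷ᵥ w) inj with elem b w in b∈w
  ... | true with () ← inj (fsuc (proj₁ (elem⇒lookup b w b∈w))) fzero (proj₂ (elem⇒lookup b w b∈w))
  ... | false = injective⇒distinct w (λ i j wi≡wj → Finₚ.suc-injective (inj (fsuc i) (fsuc j) wi≡wj))

  permCount≤n! : (n : ℕ) → permCount n ≤ n !
  permCount≤n! n = begin
    permCount n                 ≤⟨ ∑-mono (allVecs n n) perm⇒distinct ⟩
    distinctCount n n           ≡⟨ ℕ.*-identityʳ _ ⟨
    distinctCount n n * 1       ≡⟨ cong (λ z → distinctCount n n * z !) (ℕ.n∸n≡0 n) ⟨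
    distinctCount n n * (n ∸ n) ! ≤⟨ distinctCount-bound n n ⟩
    n !                         ∎
    where
    open ℕ.≤-Reasoning
    perm⇒distinct : ∀ v → 𝟙 (isPerm v) * 1 ≤ 𝟙 (distinct v)
    perm⇒distinct v with isPerm v in perm
    ... | false = z≤n
    ... | true = ℕ.≤-reflexive (cong 𝟙 (sym (injective⇒distinct v (isInjective⇒injective (lookup v) perm))))

  member : ∀ {n} → Cosets n → Cell n → Bool
  member C (i , j) = C i j

  card≡∑Cell : ∀ {n} (C : Cosets n) → card C ≡ ∑Cell n (𝟙 ∘ member C)
  card≡∑Cell {n} C = trans (countB≡∑ (allPairs n) _) (∑-cong (allPairs n) λ { (i , j) → refl })

  hit : ∀ {n} → Vec (Fin n) n → Cell n → ℕ
  hit v (i , j) = 𝟙 (lookup v i ≟ᵇ j)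

  hᵥ : ∀ {n} → Cosets n → Vec (Fin n) n → ℕ
  hᵥ {n} C v = ∑Cell n (λ c → 𝟙 (member C c) * hit v c)

  sumX≡hᵥ : ∀ {n} (C : Cosets n) (v : Vec (Fin n) n) → sumX C (lookup v) ≡ hᵥ C v
  sumX≡hᵥ {n} C v = trans (foldr-+-map≡∑ (allPairs n) _) (∑-cong (allPairs n) term)
    where
    term : ∀ c → (if member C c then x (proj₁ c) (proj₂ c) (lookup v) else 0) ≡ 𝟙 (member C c) * hit v c
    term (i , j) with C i j | lookup v i ≟ᵇ j
    ... | true | true = refl
    ... | true | false = refl
    ... | false | _ = refl

  first-moment : ∀ {n} (C : Cosets n) → ∑Perm n (hᵥ C) * n ≡ card C * permCount n
  first-moment {n} C = begin
    ∑Perm n (hᵥ C) * n                                            ≡⟨ cong (_* n) (∑Perm-∑ n (allPairs n) _) ⟩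
    ∑Cell n (λ c → ∑Perm n (λ v → 𝟙 (member C c) * hit v c)) * n ≡⟨ ∑-*ʳ (allPairs n) _ n ⟩
    ∑Cell n (λ c → ∑Perm n (λ v → 𝟙 (member C c) * hit v c) * n) ≡⟨ ∑-cong (allPairs n) each-cell ⟩
    ∑Cell n (λ c → 𝟙 (member C c) * permCount n)                 ≡⟨ ∑-*ʳ (allPairs n) _ (permCount n) ⟨
    ∑Cell n (𝟙 ∘ member C) * permCount n                          ≡⟨ cong (_* permCount n) (card≡∑Cell C) ⟨
    card C * permCount n                                          ∎
    where
    open ≡-Reasoning
    each-cell : ∀ c → ∑Perm n (λ v → 𝟙 (member C c) * hit v c) * n ≡ 𝟙 (member C c) * permCount n
    each-cell (i , j) = trans (cong (_* n) (∑Perm-*ˡ n (𝟙 (C i j)) _))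
                              (trans (ℕ.*-assoc (𝟙 (C i j)) _ n) (cong (𝟙 (C i j) *_) (hits*n≡permCount n i j)))

  coHits : ∀ {n} → Cell n → Cell n → ℕ
  coHits {n} c d = ∑Perm n (λ v → hit v c * hit v d)

  coHits-bound : ∀ {n} (c d : Cell n) →
    coHits c d * n * n ≤ 𝟙 (sameCell c d) * (permCount n * n) + 𝟙 (nonDisjoint c d) * (2 * permCount n)
  coHits-bound {n} (i , j) (k , l) with ≟ᵇ-view i k | ≟ᵇ-view j l
  ... | inj₁ (eq , refl) | inj₁ (eq′ , refl) rewrite eq | eq′ =
    ℕ.≤-trans (ℕ.≤-reflexive same) (ℕ.m≤m+n (permCount n * n + 0) _)
    where
    same : coHits (i , j) (i , j) * n * n ≡ permCount n * n + 0
    same = trans (cong (λ z → z * n * n) (∑Perm-cong n λ v _ → 𝟙-idem _))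
                 (trans (cong (_* n) (hits*n≡permCount n i j)) (sym (ℕ.+-identityʳ _)))
  ... | inj₁ (eq , refl) | inj₂ (eq′ , j≢l) rewrite eq | eq′ =
    ℕ.≤-reflexive (cong (λ z → z * n * n) (∑Perm-zero n _ λ v _ → 𝟙-≟ᵇ-distinct-targets (lookup v i) j l j≢l))
  ... | inj₂ (eq , i≢k) | inj₁ (eq′ , refl) rewrite eq | eq′ =
    ℕ.≤-reflexive (cong (λ z → z * n * n) (∑Perm-zero n _ λ v perm → 𝟙-≟ᵇ-distinct-sources v perm i k j i≢k))
  ... | inj₂ (eq , i≢k) | inj₂ (eq′ , j≢l) rewrite eq | eq′ =
    ℕ.≤-trans (jointHits-bound n i j k l i≢k j≢l) (ℕ.≤-reflexive (sym (ℕ.+-identityʳ _)))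

  crossPairs : ∀ {n} → Cosets n → Cosets n → ℕ
  crossPairs {n} R D = ∑Cell n (λ c → ∑Cell n (λ d → 𝟙 (member R c) * (𝟙 (member D d) * 𝟙 (nonDisjoint c d))))

  orderedPairs : ∀ {n} → Cosets n → ℕ
  orderedPairs C = crossPairs C C

  inBoth : ∀ {n} → Cosets n → Cell n → Cell n → ℕ
  inBoth C c d = 𝟙 (member C c) * 𝟙 (member C d)

  ∑Perm-h²≡∑coHits : ∀ {n} (C : Cosets n) →
    ∑Perm n (λ v → hᵥ C v * hᵥ C v) ≡ ∑Cell n (λ c → ∑Cell n (λ d → inBoth C c d * coHits c d))
  ∑Perm-h²≡∑coHits {n} C = begin
    ∑Perm n (λ v → hᵥ C v * hᵥ C v)                                         ≡⟨ ∑Perm-cong n (λ v _ → expand v) ⟩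
    ∑Perm n (λ v → ∑Cell n (λ c → ∑Cell n (λ d → inBoth C c d * (hit v d * hit v c)))) ≡⟨ ∑Perm-∑ n (allPairs n) _ ⟩
    ∑Cell n (λ c → ∑Perm n (λ v → ∑Cell n (λ d → inBoth C c d * (hit v d * hit v c)))) ≡⟨ ∑-cong (allPairs n) pull-out ⟩
    ∑Cell n (λ c → ∑Cell n (λ d → inBoth C c d * coHits c d))               ∎
    where
    open ≡-Reasoning
    rearrange : ∀ a b c d → (a * b) * (c * d) ≡ (c * a) * (b * d)
    rearrange = solve-∀
    expand : ∀ v → hᵥ C v * hᵥ C v ≡ ∑Cell n (λ c → ∑Cell n (λ d → inBoth C c d * (hit v d * hit v c)))
    expand v = trans (∑-*ʳ (allPairs n) _ (hᵥ C v)) (∑-cong (allPairs n) λ c →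
      trans (ℕ.*-comm _ (hᵥ C v)) (trans (∑-*ʳ (allPairs n) _ _) (∑-cong (allPairs n) λ d →
        rearrange (𝟙 (member C d)) (hit v d) (𝟙 (member C c)) (hit v c))))
    pull-out : ∀ c → ∑Perm n (λ v → ∑Cell n (λ d → inBoth C c d * (hit v d * hit v c)))
                   ≡ ∑Cell n (λ d → inBoth C c d * coHits c d)
    pull-out c = trans (∑Perm-∑ n (allPairs n) _) (∑-cong (allPairs n) λ d →
      trans (∑Perm-*ˡ n (inBoth C c d) _) (cong (inBoth C c d *_) (∑Perm-cong n λ v _ → ℕ.*-comm (hit v d) (hit v c))))

  ∑inBoth-sameCell : ∀ {n} (C : Cosets n) (k : ℕ) →
    ∑Cell n (λ c → ∑Cell n (λ d → inBoth C c d * (𝟙 (sameCell c d) * k))) ≡ card C * k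
  ∑inBoth-sameCell {n} C k = begin
    ∑Cell n (λ c → ∑Cell n (λ d → inBoth C c d * (𝟙 (sameCell c d) * k))) ≡⟨ ∑-cong (allPairs n) diagonal ⟩
    ∑Cell n (λ c → 𝟙 (member C c) * k)                                    ≡⟨ ∑-*ʳ (allPairs n) _ k ⟨
    ∑Cell n (𝟙 ∘ member C) * k                                             ≡⟨ cong (_* k) (card≡∑Cell C) ⟨
    card C * k                                                             ∎
    where
    open ≡-Reasoning
    rearrange : ∀ a b e k → a * b * (e * k) ≡ a * k * (e * b)
    rearrange = solve-∀
    diagonal : ∀ c → ∑Cell n (λ d → inBoth C c d * (𝟙 (sameCell c d) * k)) ≡ 𝟙 (member C c) * k
    diagonal c = begin
      ∑Cell n (λ d → inBoth C c d * (𝟙 (sameCell c d) * k))          ≡⟨ ∑-cong (allPairs n) (λ d → rearrange (𝟙 (member C c)) (𝟙 (member C d)) (𝟙 (sameCell c d)) k) ⟩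
      ∑Cell n (λ d → 𝟙 (member C c) * k * (𝟙 (sameCell c d) * 𝟙 (member C d))) ≡⟨ ∑-*ˡ (allPairs n) (𝟙 (member C c) * k) (λ d → 𝟙 (sameCell c d) * 𝟙 (member C d)) ⟩
      𝟙 (member C c) * k * ∑Cell n (λ d → 𝟙 (sameCell c d) * 𝟙 (member C d)) ≡⟨ cong (𝟙 (member C c) * k *_) (∑Cell-δ n c (𝟙 ∘ member C)) ⟩
      𝟙 (member C c) * k * 𝟙 (member C c)                             ≡⟨ ℕ.*-comm (𝟙 (member C c) * k) (𝟙 (member C c)) ⟩
      𝟙 (member C c) * (𝟙 (member C c) * k)                           ≡⟨ ℕ.*-assoc (𝟙 (member C c)) _ k ⟨
      𝟙 (member C c) * 𝟙 (member C c) * k                             ≡⟨ cong (_* k) (𝟙-idem (member C c)) ⟩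
      𝟙 (member C c) * k                                              ∎

  ∑inBoth-nonDisjoint : ∀ {n} (C : Cosets n) (k : ℕ) →
    ∑Cell n (λ c → ∑Cell n (λ d → inBoth C c d * (𝟙 (nonDisjoint c d) * k))) ≡ orderedPairs C * k
  ∑inBoth-nonDisjoint {n} C k = sym (trans (∑-*ʳ (allPairs n) _ k) (∑-cong (allPairs n) λ c →
    trans (∑-*ʳ (allPairs n) _ k) (∑-cong (allPairs n) λ d →
      reassociate (𝟙 (member C c)) (𝟙 (member C d)) (𝟙 (nonDisjoint c d)) k)))
    where
    reassociate : ∀ a b e k → a * (b * e) * k ≡ a * b * (e * k)
    reassociate = solve-∀

  second-moment-bound : ∀ {n} (C : Cosets n) →
    ∑Perm n (λ v → hᵥ C v * hᵥ C v) * n * n ≤ card C * (permCount n * n) + orderedPairs C * (2 * permCount n)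
  second-moment-bound {n} C = begin
    ∑Perm n (λ v → hᵥ C v * hᵥ C v) * n * n                          ≡⟨ cong (λ z → z * n * n) (∑Perm-h²≡∑coHits C) ⟩
    ∑Cell n (λ c → ∑Cell n (λ d → inBoth C c d * coHits c d)) * n * n ≡⟨ distribute-n² ⟩
    ∑Cell n (λ c → ∑Cell n (λ d → inBoth C c d * (coHits c d * n * n))) ≤⟨ ∑-mono (allPairs n) (λ c → ∑-mono (allPairs n) λ d →
                                                                            ℕ.*-monoʳ-≤ (inBoth C c d) (coHits-bound c d)) ⟩
    ∑Cell n (λ c → ∑Cell n (λ d → inBoth C c d * (𝟙 (sameCell c d) * (p * n) + 𝟙 (nonDisjoint c d) * (2 * p))))
                                                                       ≡⟨ split-sums ⟩
    ∑Cell n (λ c → ∑Cell n (λ d → inBoth C c d * (𝟙 (sameCell c d) * (p * n))))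
      + ∑Cell n (λ c → ∑Cell n (λ d → inBoth C c d * (𝟙 (nonDisjoint c d) * (2 * p))))
                                                                       ≡⟨ cong₂ _+_ (∑inBoth-sameCell C (p * n)) (∑inBoth-nonDisjoint C (2 * p)) ⟩
    card C * (p * n) + orderedPairs C * (2 * p)                        ∎
    where
    open ℕ.≤-Reasoning
    p : ℕ
    p = permCount n
    reassociate : ∀ w s n → w * s * (n * n) ≡ w * (s * n * n)
    reassociate = solve-∀
    distribute-n² : ∑Cell n (λ c → ∑Cell n (λ d → inBoth C c d * coHits c d)) * n * n
                  ≡ ∑Cell n (λ c → ∑Cell n (λ d → inBoth C c d * (coHits c d * n * n)))
    distribute-n² = trans (ℕ.*-assoc (∑Cell n (λ c → ∑Cell n (λ d → inBoth C c d * coHits c d))) n n)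
      (trans (∑-*ʳ (allPairs n) (λ c → ∑Cell n (λ d → inBoth C c d * coHits c d)) (n * n)) (∑-cong (allPairs n) λ c →
      trans (∑-*ʳ (allPairs n) (λ d → inBoth C c d * coHits c d) (n * n)) (∑-cong (allPairs n) λ d → reassociate (inBoth C c d) (coHits c d) n)))
    split-sums : ∑Cell n (λ c → ∑Cell n (λ d → inBoth C c d * (𝟙 (sameCell c d) * (p * n) + 𝟙 (nonDisjoint c d) * (2 * p))))
               ≡ ∑Cell n (λ c → ∑Cell n (λ d → inBoth C c d * (𝟙 (sameCell c d) * (p * n))))
                 + ∑Cell n (λ c → ∑Cell n (λ d → inBoth C c d * (𝟙 (nonDisjoint c d) * (2 * p))))
    split-sums = trans (∑-cong (allPairs n) λ c → trans (∑-cong (allPairs n) λ d →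
                   ℕ.*-distribˡ-+ (inBoth C c d) (𝟙 (sameCell c d) * (p * n)) (𝟙 (nonDisjoint c d) * (2 * p)))
                   (∑-+ (allPairs n) (λ d → inBoth C c d * (𝟙 (sameCell c d) * (p * n)))
                                     (λ d → inBoth C c d * (𝟙 (nonDisjoint c d) * (2 * p)))))
                 (∑-+ (allPairs n) _ _)

  nonDisjoint-sym : ∀ {n} (c d : Cell n) → nonDisjoint c d ≡ nonDisjoint d c
  nonDisjoint-sym (i , j) (k , l) = cong₂ (λ a b → not a ∧ not b) (≟ᵇ-sym i k) (≟ᵇ-sym j l)

  nonDisjoint⇒rows≢ : ∀ {n} (i j k l : Fin n) → nonDisjoint (i , j) (k , l) ≡ true → ¬ i ≡ k
  nonDisjoint⇒rows≢ i j k l nd refl rewrite ≟ᵇ-refl i with () ← nd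

  code≡⇒rows≡ : ∀ {n} (i j k l : Fin n) → code (i , j) ≡ code (k , l) → i ≡ k
  code≡⇒rows≡ {n} i j k l eq = Finₚ.combine-injectiveˡ i j k l (Finₚ.toℕ-injective (begin
    toℕ (combine i j)          ≡⟨ Finₚ.toℕ-combine i j ⟩
    n * toℕ i + toℕ j          ≡⟨ cong (_+ toℕ j) (ℕ.*-comm n (toℕ i)) ⟩
    code (i , j)               ≡⟨ eq ⟩
    code (k , l)               ≡⟨ cong (_+ toℕ l) (ℕ.*-comm (toℕ k) n) ⟩
    n * toℕ k + toℕ l          ≡⟨ Finₚ.toℕ-combine k l ⟨
    toℕ (combine k l)          ∎))
    where open ≡-Reasoning

  countedPair : ∀ {n} → Cosets n → Cell n → Cell n → ℕ
  countedPair C c d = 𝟙 (member C c ∧ (member C d ∧ ((code c <ᵇ code d) ∧ nonDisjoint c d)))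

  nonDisjointPairs≡∑∑ : ∀ {n} (C : Cosets n) → nonDisjointPairs C ≡ ∑Cell n (λ c → ∑Cell n (countedPair C c))
  nonDisjointPairs≡∑∑ {n} C = trans (countB≡∑ (concatMap (λ c → map (c ,_) (allPairs n)) (allPairs n)) _)
    (trans (∑-concatMap (λ c → map (c ,_) (allPairs n)) (allPairs n) _)
           (∑-cong (allPairs n) λ c → ∑-map (c ,_) (allPairs n) _))

  T⇒≡true : ∀ {b} → T b → b ≡ true
  T⇒≡true {true} _ = refl

  ordered≤counted-either-way : ∀ {n} (C : Cosets n) (c d : Cell n) →
    𝟙 (member C c) * (𝟙 (member C d) * 𝟙 (nonDisjoint c d)) ≤ countedPair C c d + countedPair C d c
  ordered≤counted-either-way C (i , j) (k , l) with C i j | C k l | nonDisjoint (i , j) (k , l) in nd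
  ... | true | true | true = by-code-order (ℕ.<-cmp (code (i , j)) (code (k , l)))
    where
    by-code-order : _ → 1 ≤ 𝟙 ((code (i , j) <ᵇ code (k , l)) ∧ true)
                          + 𝟙 (true ∧ (true ∧ ((code (k , l) <ᵇ code (i , j)) ∧ nonDisjoint (k , l) (i , j))))
    by-code-order (tri< lt _ _) rewrite T⇒≡true (ℕ.<⇒<ᵇ lt) = s≤s z≤n
    by-code-order (tri≈ _ eq _) = ⊥-elim (nonDisjoint⇒rows≢ i j k l nd (code≡⇒rows≡ i j k l eq))
    by-code-order (tri> _ _ gt) rewrite T⇒≡true (ℕ.<⇒<ᵇ gt) | sym (nonDisjoint-sym (i , j) (k , l)) | nd = ℕ.m≤n+m 1 _
  ... | true | true | false = z≤n
  ... | true | false | _ = z≤n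
  ... | false | _ | _ = z≤n

  orderedPairs≤2*nonDisjointPairs : ∀ {n} (C : Cosets n) → orderedPairs C ≤ 2 * nonDisjointPairs C
  orderedPairs≤2*nonDisjointPairs {n} C = begin
    orderedPairs C                                                  ≤⟨ ∑-mono (allPairs n) (λ c → ∑-mono (allPairs n) (ordered≤counted-either-way C c)) ⟩
    ∑Cell n (λ c → ∑Cell n (λ d → countedPair C c d + countedPair C d c)) ≡⟨ split ⟩
    N′ + ∑Cell n (λ c → ∑Cell n (λ d → countedPair C d c))           ≡⟨ cong (N′ +_) (∑-comm (allPairs n) (allPairs n) (λ c d → countedPair C d c)) ⟩
    N′ + N′                                                          ≡⟨ cong (λ z → z + z) (nonDisjointPairs≡∑∑ C) ⟨
    nonDisjointPairs C + nonDisjointPairs C                          ≡⟨ cong (nonDisjointPairs C +_) (ℕ.+-identityʳ _) ⟨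
    2 * nonDisjointPairs C                                           ∎
    where
    open ℕ.≤-Reasoning
    N′ : ℕ
    N′ = ∑Cell n (λ c → ∑Cell n (countedPair C c))
    split : ∑Cell n (λ c → ∑Cell n (λ d → countedPair C c d + countedPair C d c))
          ≡ N′ + ∑Cell n (λ c → ∑Cell n (λ d → countedPair C d c))
    split = trans (∑-cong (allPairs n) λ c → ∑-+ (allPairs n) (countedPair C c) (λ d → countedPair C d c)) (∑-+ (allPairs n) _ _)

  orderedPairs≤card² : ∀ {n} (C : Cosets n) → orderedPairs C ≤ card C * card C
  orderedPairs≤card² {n} C = begin
    orderedPairs C                                        ≤⟨ ∑-mono (allPairs n) (λ c → ∑-mono (allPairs n) λ d →
                                                               ℕ.*-monoʳ-≤ (𝟙 (member C c)) (𝟙-*-≤ (member C d) (nonDisjoint c d))) ⟩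
    ∑Cell n (λ c → ∑Cell n (λ d → 𝟙 (member C c) * 𝟙 (member C d))) ≡⟨ ∑-cong (allPairs n) (λ c → ∑-*ˡ (allPairs n) (𝟙 (member C c)) _) ⟩
    ∑Cell n (λ c → 𝟙 (member C c) * ∑Cell n (𝟙 ∘ member C))  ≡⟨ ∑-*ʳ (allPairs n) _ _ ⟨
    ∑Cell n (𝟙 ∘ member C) * ∑Cell n (𝟙 ∘ member C)          ≡⟨ cong₂ _*_ (card≡∑Cell C) (card≡∑Cell C) ⟨
    card C * card C                                       ∎
    where
    open ℕ.≤-Reasoning
    𝟙-*-≤ : ∀ a b → 𝟙 a * 𝟙 b ≤ 𝟙 a
    𝟙-*-≤ a true = ℕ.≤-reflexive (ℕ.*-identityʳ (𝟙 a))
    𝟙-*-≤ a false = ℕ.≤-trans (ℕ.≤-reflexive (ℕ.*-zeroʳ (𝟙 a))) z≤n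

  _∩_ : ∀ {n} → Cosets n → (Cell n → Bool) → Cosets n
  (C ∩ L) i j = C i j ∧ L (i , j)

  _∖_ : ∀ {n} → Cosets n → (Cell n → Bool) → Cosets n
  (C ∖ L) i j = C i j ∧ not (L (i , j))

  _⊆_ : ∀ {n} → Cosets n → Cosets n → Set
  R ⊆ C = ∀ c → member R c ≡ true → member C c ≡ true

  ∖-⊆ : ∀ {n} (C : Cosets n) (L : Cell n → Bool) → (C ∖ L) ⊆ C
  ∖-⊆ C L (i , j) c∈ with C i j
  ... | true = refl

  ∩-⊆ : ∀ {n} (C : Cosets n) (L : Cell n → Bool) → (C ∩ L) ⊆ C
  ∩-⊆ C L (i , j) c∈ with C i j
  ... | true = refl

  𝟙-split : ∀ (c l : Bool) → 𝟙 c ≡ 𝟙 (c ∧ l) + 𝟙 (c ∧ not l)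
  𝟙-split true true = refl
  𝟙-split true false = refl
  𝟙-split false l = refl

  card-split : ∀ {n} (C : Cosets n) (L : Cell n → Bool) → card C ≡ card (C ∩ L) + card (C ∖ L)
  card-split {n} C L = begin
    card C                                                             ≡⟨ card≡∑Cell C ⟩
    ∑Cell n (𝟙 ∘ member C)                                             ≡⟨ ∑-cong (allPairs n) (λ c → 𝟙-split (member C c) (L c)) ⟩
    ∑Cell n (λ c → 𝟙 (member C c ∧ L c) + 𝟙 (member C c ∧ not (L c)))   ≡⟨ ∑-+ (allPairs n) _ _ ⟩
    ∑Cell n (𝟙 ∘ member (C ∩ L)) + ∑Cell n (𝟙 ∘ member (C ∖ L))         ≡⟨ cong₂ _+_ (card≡∑Cell (C ∩ L)) (card≡∑Cell (C ∖ L)) ⟨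
    card (C ∩ L) + card (C ∖ L)                                        ∎
    where open ≡-Reasoning

  card-∩ : ∀ {n} (C : Cosets n) (L : Cell n → Bool) → card (C ∩ L) ≡ ∑Cell n (λ d → 𝟙 (member C d) * 𝟙 (L d))
  card-∩ {n} C L = trans (card≡∑Cell (C ∩ L)) (∑-cong (allPairs n) λ d → 𝟙-∧ (member C d) (L d))

  sumX-split : ∀ {n} (C : Cosets n) (L : Cell n → Bool) (π : Fin n → Fin n) →
    sumX C π ≡ sumX (C ∩ L) π + sumX (C ∖ L) π
  sumX-split {n} C L π = trans (foldr-+-map≡∑ (allPairs n) _) (trans (∑-cong (allPairs n) term)
    (trans (∑-+ (allPairs n) _ _) (sym (cong₂ _+_ (foldr-+-map≡∑ (allPairs n) _) (foldr-+-map≡∑ (allPairs n) _)))))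
    where
    xIn : Cosets n → Cell n → ℕ
    xIn D (i , j) = if D i j then x i j π else 0
    term : ∀ c → xIn C c ≡ xIn (C ∩ L) c + xIn (C ∖ L) c
    term (i , j) with C i j | L (i , j)
    ... | true | true = sym (ℕ.+-identityʳ _)
    ... | true | false = refl
    ... | false | _ = refl

  crossPairs-mono : ∀ {n} {R R′ D D′ : Cosets n} → R ⊆ R′ → D ⊆ D′ → crossPairs R D ≤ crossPairs R′ D′
  crossPairs-mono {n} {R} {R′} {D} {D′} R⊆R′ D⊆D′ = ∑-mono (allPairs n) λ c → ∑-mono (allPairs n) λ d →
    ℕ.*-mono-≤ (𝟙-mono (R⊆R′ c)) (ℕ.*-monoˡ-≤ (𝟙 (nonDisjoint c d)) (𝟙-mono (D⊆D′ d)))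
    where
    𝟙-mono : ∀ {a b} → (a ≡ true → b ≡ true) → 𝟙 a ≤ 𝟙 b
    𝟙-mono {true} a⇒b rewrite a⇒b refl = ℕ.≤-refl
    𝟙-mono {false} _ = z≤n

  sameRow sameCol : ∀ {n} → Cell n → Cell n → Bool
  sameRow c d = proj₁ c ≟ᵇ proj₁ d
  sameCol c d = proj₂ c ≟ᵇ proj₂ d

  crossMass : ∀ {n} → Cosets n → Cell n → ℕ
  crossMass C c = card (C ∩ sameRow c) + card (C ∩ sameCol c)

  degree : ∀ {n} → Cosets n → Cell n → ℕ
  degree {n} C c = ∑Cell n (λ d → 𝟙 (member C d) * 𝟙 (nonDisjoint c d))

  -- Every cell d is non-disjoint from c, in the row of c, or in its column; only c itself is in both.
  degree+crossMass : ∀ {n} (C : Cosets n) (c : Cell n) → degree C c + crossMass C c ≡ card C + 𝟙 (member C c)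
  degree+crossMass {n} C (c₁ , c₂) = begin
    degree C c + (card (C ∩ sameRow c) + card (C ∩ sameCol c))    ≡⟨ cong (degree C c +_) (cong₂ _+_ (card-∩ C (sameRow c)) (card-∩ C (sameCol c))) ⟩
    ∑Cell n (λ d → m d * 𝟙 (nonDisjoint c d)) + (∑Cell n (λ d → m d * 𝟙 (sameRow c d)) + ∑Cell n (λ d → m d * 𝟙 (sameCol c d)))
                                                                    ≡⟨ cong (degree C c +_) (∑-+ (allPairs n) _ _) ⟨
    ∑Cell n (λ d → m d * 𝟙 (nonDisjoint c d)) + ∑Cell n (λ d → m d * 𝟙 (sameRow c d) + m d * 𝟙 (sameCol c d))
                                                                    ≡⟨ ∑-+ (allPairs n) _ _ ⟨
    ∑Cell n (λ d → m d * 𝟙 (nonDisjoint c d) + (m d * 𝟙 (sameRow c d) + m d * 𝟙 (sameCol c d)))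
                                                                    ≡⟨ ∑-cong (allPairs n) each ⟩
    ∑Cell n (λ d → m d + 𝟙 (sameCell c d) * m d)                   ≡⟨ ∑-+ (allPairs n) _ _ ⟩
    ∑Cell n m + ∑Cell n (λ d → 𝟙 (sameCell c d) * m d)             ≡⟨ cong₂ _+_ (sym (card≡∑Cell C)) (∑Cell-δ n c m) ⟩
    card C + 𝟙 (member C c)                                         ∎
    where
    open ≡-Reasoning
    c : Cell n
    c = (c₁ , c₂)
    m : Cell n → ℕ
    m = 𝟙 ∘ member C
    trichotomy : ∀ a b → 𝟙 (not a ∧ not b) + (𝟙 a + 𝟙 b) ≡ 1 + 𝟙 (a ∧ b)
    trichotomy true true = refl
    trichotomy true false = refl
    trichotomy false true = refl
    trichotomy false false = refl
    factor : ∀ x y z w → x * y + (x * z + x * w) ≡ x * (y + (z + w))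
    factor = solve-∀
    unfactor : ∀ x e → x * (1 + e) ≡ x + e * x
    unfactor = solve-∀
    each : ∀ d → m d * 𝟙 (nonDisjoint c d) + (m d * 𝟙 (sameRow c d) + m d * 𝟙 (sameCol c d)) ≡ m d + 𝟙 (sameCell c d) * m d
    each (d₁ , d₂) = trans (factor (m (d₁ , d₂)) _ _ _) (trans (cong (m (d₁ , d₂) *_) (trichotomy (c₁ ≟ᵇ d₁) (c₂ ≟ᵇ d₂)))
                           (unfactor (m (d₁ , d₂)) (𝟙 (sameCell c (d₁ , d₂)))))

  card²+card≡orderedPairs+∑crossMass : ∀ {n} (C : Cosets n) →
    card C * card C + card C ≡ orderedPairs C + ∑Cell n (λ c → 𝟙 (member C c) * crossMass C c)
  card²+card≡orderedPairs+∑crossMass {n} C = begin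
    a * a + a                                                        ≡⟨ cong₂ _+_ (cong (_* a) (card≡∑Cell C)) (card≡∑Cell C) ⟩
    ∑Cell n m * a + ∑Cell n m                                        ≡⟨ cong (_+ ∑Cell n m) (∑-*ʳ (allPairs n) m a) ⟩
    ∑Cell n (λ c → m c * a) + ∑Cell n m                              ≡⟨ ∑-+ (allPairs n) _ _ ⟨
    ∑Cell n (λ c → m c * a + m c)                                    ≡⟨ ∑-cong (allPairs n) each ⟩
    ∑Cell n (λ c → m c * degree C c + m c * crossMass C c)            ≡⟨ ∑-+ (allPairs n) _ _ ⟩
    ∑Cell n (λ c → m c * degree C c) + ∑Cell n (λ c → m c * crossMass C c) ≡⟨ cong (_+ ∑Cell n (λ c → m c * crossMass C c)) orderedPairs≡∑degree ⟨
    orderedPairs C + ∑Cell n (λ c → m c * crossMass C c)              ∎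
    where
    open ≡-Reasoning
    a : ℕ
    a = card C
    m : Cell n → ℕ
    m = 𝟙 ∘ member C
    orderedPairs≡∑degree : orderedPairs C ≡ ∑Cell n (λ c → m c * degree C c)
    orderedPairs≡∑degree = ∑-cong (allPairs n) λ c → ∑-*ˡ (allPairs n) (m c) _
    distrib : ∀ x a i → x * (a + i) ≡ x * a + x * i
    distrib = solve-∀
    each : ∀ c → m c * a + m c ≡ m c * degree C c + m c * crossMass C c
    each c = begin
      m c * a + m c                              ≡⟨ cong (m c * a +_) (𝟙-idem (member C c)) ⟨
      m c * a + m c * m c                        ≡⟨ distrib (m c) a (m c) ⟨
      m c * (a + m c)                            ≡⟨ cong (m c *_) (degree+crossMass C c) ⟨
      m c * (degree C c + crossMass C c)          ≡⟨ distrib (m c) (degree C c) (crossMass C c) ⟩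
      m c * degree C c + m c * crossMass C c      ∎

  ∑-≤-bound : ∀ {A : Set} (g : A → ℕ) (w : A → ℕ) (M : ℕ) (xs : List A) →
    All (λ x → g x ≤ M) xs → ∑ xs (λ x → w x * g x) ≤ ∑ xs w * M
  ∑-≤-bound g w M [] [] = z≤n
  ∑-≤-bound g w M (x ∷ xs) (gx≤M ∷ gxs≤M) = begin
    w x * g x + ∑ xs (λ x → w x * g x) ≤⟨ ℕ.+-mono-≤ (ℕ.*-monoʳ-≤ (w x) gx≤M) (∑-≤-bound g w M xs gxs≤M) ⟩
    w x * M + ∑ xs w * M               ≡⟨ ℕ.*-distribʳ-+ M (w x) _ ⟨
    (w x + ∑ xs w) * M                 ∎
    where open ℕ.≤-Reasoning

  AtMostOneDisjoint : ∀ {n} → (Cell n → Bool) → (Cell n → Cell n) → Set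
  AtMostOneDisjoint {n} L ρ = ∀ d e → L e ≡ true → L d ≡ false → nonDisjoint d e ≡ false → sameCell (ρ d) e ≡ true

  card∩≤degree+1 : ∀ {n} (C : Cosets n) (L : Cell n → Bool) (ρ : Cell n → Cell n) → AtMostOneDisjoint L ρ →
    ∀ d → L d ≡ false → card (C ∩ L) ≤ degree (C ∩ L) d + 1
  card∩≤degree+1 {n} C L ρ one d d∉L = begin
    card D                                                                   ≡⟨ card≡∑Cell D ⟩
    ∑Cell n (𝟙 ∘ member D)                                                   ≡⟨ ∑-cong (allPairs n) split ⟩
    ∑Cell n (λ e → 𝟙 (member D e) * 𝟙 (nonDisjoint d e) + 𝟙 (member D e) * 𝟙 (not (nonDisjoint d e)))
                                                                             ≡⟨ ∑-+ (allPairs n) _ _ ⟩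
    degree D d + ∑Cell n (λ e → 𝟙 (member D e) * 𝟙 (not (nonDisjoint d e))) ≤⟨ ℕ.+-monoʳ-≤ (degree D d) at-most-one ⟩
    degree D d + 1                                                           ∎
    where
    open ℕ.≤-Reasoning
    D : Cosets n
    D = C ∩ L
    split : ∀ e → 𝟙 (member D e) ≡ 𝟙 (member D e) * 𝟙 (nonDisjoint d e) + 𝟙 (member D e) * 𝟙 (not (nonDisjoint d e))
    split e with member D e
    ... | false = refl
    ... | true with nonDisjoint d e
    ...   | true = refl
    ...   | false = refl
    only-ρd : ∀ e → 𝟙 (member D e) * 𝟙 (not (nonDisjoint d e)) ≤ 𝟙 (sameCell (ρ d) e) * 1
    only-ρd (i , j) with C i j | L (i , j) in e∈L | nonDisjoint d (i , j) in nd
    ... | true | true | false rewrite one d (i , j) e∈L d∉L nd = ℕ.≤-refl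
    ... | true | true | true = z≤n
    ... | true | false | _ = z≤n
    ... | false | _ | _ = z≤n
    at-most-one : ∑Cell n (λ e → 𝟙 (member D e) * 𝟙 (not (nonDisjoint d e))) ≤ 1
    at-most-one = ℕ.≤-trans (∑-mono (allPairs n) only-ρd) (ℕ.≤-reflexive (∑Cell-δ n (ρ d) (λ _ → 1)))

  off-line-bound : ∀ {n} (C : Cosets n) (L : Cell n → Bool) (ρ : Cell n → Cell n) → AtMostOneDisjoint L ρ →
    card (C ∖ L) * card (C ∩ L) ≤ orderedPairs C + card (C ∖ L)
  off-line-bound {n} C L ρ one = begin
    r * m                                                     ≡⟨ cong (_* m) (card≡∑Cell R) ⟩
    ∑Cell n (𝟙 ∘ member R) * m                                ≡⟨ ∑-*ʳ (allPairs n) _ m ⟩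
    ∑Cell n (λ d → 𝟙 (member R d) * m)                        ≤⟨ ∑-mono (allPairs n) each ⟩
    ∑Cell n (λ d → 𝟙 (member R d) * (degree D d + 1))          ≡⟨ ∑-cong (allPairs n) distrib ⟩
    ∑Cell n (λ d → 𝟙 (member R d) * degree D d + 𝟙 (member R d)) ≡⟨ ∑-+ (allPairs n) _ _ ⟩
    ∑Cell n (λ d → 𝟙 (member R d) * degree D d) + ∑Cell n (𝟙 ∘ member R)
                                                              ≡⟨ cong₂ _+_ crossPairs≡ (sym (card≡∑Cell R)) ⟩
    crossPairs R D + r                                        ≤⟨ ℕ.+-monoˡ-≤ r (crossPairs-mono (∖-⊆ C L) (∩-⊆ C L)) ⟩
    orderedPairs C + r                                        ∎
    where
    open ℕ.≤-Reasoning
    D R : Cosets n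
    D = C ∩ L
    R = C ∖ L
    m r : ℕ
    m = card D
    r = card R
    each : ∀ d → 𝟙 (member R d) * m ≤ 𝟙 (member R d) * (degree D d + 1)
    each (i , j) with C i j | L (i , j) in d∉L
    ... | true | false = ℕ.+-monoˡ-≤ 0 (card∩≤degree+1 C L ρ one (i , j) d∉L)
    ... | true | true = z≤n
    ... | false | _ = z≤n
    distrib : ∀ d → 𝟙 (member R d) * (degree D d + 1) ≡ 𝟙 (member R d) * degree D d + 𝟙 (member R d)
    distrib d = trans (ℕ.*-distribˡ-+ (𝟙 (member R d)) _ 1) (cong (𝟙 (member R d) * degree D d +_) (ℕ.*-identityʳ (𝟙 (member R d))))
    crossPairs≡ : ∑Cell n (λ d → 𝟙 (member R d) * degree D d) ≡ crossPairs R D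
    crossPairs≡ = ∑-cong (allPairs n) λ d → sym (∑-*ˡ (allPairs n) (𝟙 (member R d)) _)

  row-atMostOneDisjoint : ∀ {n} (b : Cell n) → AtMostOneDisjoint (sameRow b) (λ d → proj₁ b , proj₂ d)
  row-atMostOneDisjoint (b₁ , b₂) (d₁ , d₂) (e₁ , e₂) e∈row d∉row nd
    with refl ← ≟ᵇ⇒≡ e∈row | ≟ᵇ-view d₁ b₁
  ... | inj₁ (_ , refl) with () ← trans (sym d∉row) (≟ᵇ-refl b₁)
  ... | inj₂ (eq , _) rewrite ≟ᵇ-refl b₁ | ≟ᵇ-sym d₁ b₁ | eq with d₂ ≟ᵇ e₂
  ...   | true = refl

  col-atMostOneDisjoint : ∀ {n} (b : Cell n) → AtMostOneDisjoint (sameCol b) (λ d → proj₁ d , proj₂ b)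
  col-atMostOneDisjoint (b₁ , b₂) (d₁ , d₂) (e₁ , e₂) e∈col d∉col nd
    with refl ← ≟ᵇ⇒≡ e∈col | ≟ᵇ-view d₂ b₂
  ... | inj₁ (_ , refl) with () ← trans (sym d∉col) (≟ᵇ-refl b₂)
  ... | inj₂ (eq , _) rewrite ≟ᵇ-refl b₂ | ≟ᵇ-sym d₂ b₂ | eq with d₁ ≟ᵇ e₁
  ...   | true = refl

  heaviest-cross : ∀ {n} → Cosets n → Cell n → Cell n
  heaviest-cross {n} C default = argmax (crossMass C) default (allPairs n)

  card²+card≤orderedPairs+card*crossMass : ∀ {n} (C : Cosets n) (default : Cell n) →
    card C * card C + card C ≤ orderedPairs C + card C * crossMass C (heaviest-cross C default)
  card²+card≤orderedPairs+card*crossMass {n} C default = begin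
    card C * card C + card C                                       ≡⟨ card²+card≡orderedPairs+∑crossMass C ⟩
    orderedPairs C + ∑Cell n (λ c → 𝟙 (member C c) * crossMass C c) ≤⟨ ℕ.+-monoʳ-≤ (orderedPairs C) (∑-≤-bound (crossMass C) (𝟙 ∘ member C) _ (allPairs n)
                                                                        (f[xs]≤f[argmax] default (allPairs n))) ⟩
    orderedPairs C + ∑Cell n (𝟙 ∘ member C) * crossMass C b          ≡⟨ cong (λ z → orderedPairs C + z * crossMass C b) (card≡∑Cell C) ⟨
    orderedPairs C + card C * crossMass C b                          ∎
    where
    open ℕ.≤-Reasoning
    b : Cell n
    b = heaviest-cross C default

  record LineSplit {n : ℕ} (C : Cosets n) : Set where
    field
      line : Cell n → Bool
      dictator : IsDictator (C ∩ line)
      heavy : card C * card C + card C ≤ orderedPairs C + 2 * card C * card (C ∩ line)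
      off-line : card (C ∖ line) * card (C ∩ line) ≤ orderedPairs C + card (C ∖ line)

  *-≤-double : ∀ a {s m} → s ≤ m + m → a * s ≤ 2 * a * m
  *-≤-double a {s} {m} s≤2m = ℕ.≤-trans (ℕ.*-monoʳ-≤ a s≤2m) (ℕ.≤-reflexive (twice a m))
    where
    twice : ∀ a m → a * (m + m) ≡ 2 * a * m
    twice = solve-∀

  lineSplit-through : ∀ {n} (C : Cosets n) (b : Cell n) →
    card C * card C + card C ≤ orderedPairs C + card C * crossMass C b → LineSplit C
  lineSplit-through C b heavy with card (C ∩ sameCol b) ≤? card (C ∩ sameRow b)
  ... | yes col≤row = record
    { line = sameRow b
    ; dictator = inj₁ (proj₁ b , λ i j ij∈ → sym (≟ᵇ⇒≡ (∧-conicalʳ (C i j) _ ij∈)))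
    ; heavy = ℕ.≤-trans heavy (ℕ.+-monoʳ-≤ (orderedPairs C) (*-≤-double (card C) (ℕ.+-monoʳ-≤ _ col≤row)))
    ; off-line = off-line-bound C (sameRow b) (λ d → proj₁ b , proj₂ d) (row-atMostOneDisjoint b)
    }
  ... | no col≰row = record
    { line = sameCol b
    ; dictator = inj₂ (proj₂ b , λ i j ij∈ → sym (≟ᵇ⇒≡ (∧-conicalʳ (C i j) _ ij∈)))
    ; heavy = ℕ.≤-trans heavy (ℕ.+-monoʳ-≤ (orderedPairs C) (*-≤-double (card C) (ℕ.+-monoˡ-≤ _ (ℕ.<⇒≤ (ℕ.≰⇒> col≰row)))))
    ; off-line = off-line-bound C (sameCol b) (λ d → proj₁ d , proj₂ b) (col-atMostOneDisjoint b)
    }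

  lineSplit : ∀ {n} (C : Cosets n) → Cell n → LineSplit C
  lineSplit C default =
    lineSplit-through C (heaviest-cross C default) (card²+card≤orderedPairs+card*crossMass C default)

module Arithmetic where

  open import Data.Nat as ℕ using (ℕ; suc)
  open import Data.Integer as ℤ using (+_)
  import Data.Integer.Properties as ℤ
  open import Data.Rational using (ℚ; 0ℚ; 1ℚ; _+_; _*_; -_; _≤_; _<_; _/_; toℚᵘ; 1/_; >-nonZero; *<*; nonNegative; positive)
  open import Data.Rational.Properties
  import Data.Rational.Unnormalised as ℚᵘ
  import Data.Rational.Unnormalised.Properties as ℚᵘ
  open import Data.Rational.Solver using (module +-*-Solver)
  open +-*-Solver using (solve; _:=_; _:+_; _:*_; :-_; con)
  open import Relation.Nullary using (yes; no)
  open import Relation.Binary.PropositionalEquality using (_≡_; refl; sym; trans; cong; cong₂; subst₂)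
  open import Data.Nat.Tactic.RingSolver using (solve-∀)

  private
    ⟦_⟧ᵘ : ℕ → ℚᵘ.ℚᵘ
    ⟦ k ⟧ᵘ = ℚᵘ.mkℚᵘ (+ k) 0

    toℚᵘ-ℕ→ℚ : ∀ k → toℚᵘ (ℕ→ℚ k) ℚᵘ.≃ ⟦ k ⟧ᵘ
    toℚᵘ-ℕ→ℚ k = toℚᵘ-fromℚᵘ ⟦ k ⟧ᵘ

  ℕ→ℚ-+ : ∀ a b → ℕ→ℚ (a ℕ.+ b) ≡ ℕ→ℚ a + ℕ→ℚ b
  ℕ→ℚ-+ a b = toℚᵘ-injective (ℚᵘ.≃-trans (toℚᵘ-ℕ→ℚ (a ℕ.+ b)) (ℚᵘ.≃-sym (ℚᵘ.≃-trans (toℚᵘ-homo-+ (ℕ→ℚ a) (ℕ→ℚ b))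
    (ℚᵘ.≃-trans (ℚᵘ.+-cong (toℚᵘ-ℕ→ℚ a) (toℚᵘ-ℕ→ℚ b)) (ℚᵘ.*≡* (trans (cong₂ (λ x y → (x ℤ.+ y) ℤ.* ℤ.1ℤ) (ℤ.*-identityʳ (+ a)) (ℤ.*-identityʳ (+ b)))
      (trans (ℤ.*-identityʳ _) (trans (sym (ℤ.pos-+ a b)) (sym (ℤ.*-identityʳ _))))))))))

  ℕ→ℚ-* : ∀ a b → ℕ→ℚ (a ℕ.* b) ≡ ℕ→ℚ a * ℕ→ℚ b
  ℕ→ℚ-* a b = toℚᵘ-injective (ℚᵘ.≃-trans (toℚᵘ-ℕ→ℚ (a ℕ.* b)) (ℚᵘ.≃-sym (ℚᵘ.≃-trans (toℚᵘ-homo-* (ℕ→ℚ a) (ℕ→ℚ b))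
    (ℚᵘ.≃-trans (ℚᵘ.*-cong (toℚᵘ-ℕ→ℚ a) (toℚᵘ-ℕ→ℚ b))
      (ℚᵘ.*≡* (trans (ℤ.*-identityʳ _) (trans (sym (ℤ.pos-* a b)) (sym (ℤ.*-identityʳ _)))))))))

  ℕ→ℚ-mono : ∀ {a b} → a ℕ.≤ b → ℕ→ℚ a ≤ ℕ→ℚ b
  ℕ→ℚ-mono {a} {b} a≤b = toℚᵘ-cancel-≤ (ℚᵘ.≤-respˡ-≃ (ℚᵘ.≃-sym (toℚᵘ-ℕ→ℚ a)) (ℚᵘ.≤-respʳ-≃ (ℚᵘ.≃-sym (toℚᵘ-ℕ→ℚ b))
    (ℚᵘ.*≤* (ℤ.*-monoʳ-≤-nonNeg (+ 1) (ℤ.+≤+ a≤b)))))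

  1/N*N≡1 : ∀ N .{{_ : ℕ.NonZero N}} → ((+ 1) / N) * ℕ→ℚ N ≡ 1ℚ
  1/N*N≡1 (suc k) = toℚᵘ-injective (ℚᵘ.≃-trans (toℚᵘ-homo-* ((+ 1) / suc k) (ℕ→ℚ (suc k)))
    (ℚᵘ.≃-trans (ℚᵘ.*-cong (toℚᵘ-fromℚᵘ (ℚᵘ.mkℚᵘ (+ 1) k)) (toℚᵘ-ℕ→ℚ (suc k))) (ℚᵘ.*≡* (cong (λ z → + suc z) (identity k)))))
    where
    identity : ∀ k → (k ℕ.+ 0 ℕ.* suc k) ℕ.* 1 ≡ k ℕ.* 1 ℕ.+ 0 ℕ.* suc (k ℕ.* 1)
    identity = solve-∀

  ⌜_⌝ : ℕ → ℚ
  ⌜_⌝ = ℕ→ℚ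

  0≤⌜_⌝ : ∀ k → 0ℚ ≤ ⌜ k ⌝
  0≤⌜ k ⌝ = ℕ→ℚ-mono {0} {k} ℕ.z≤n

  0<⌜_⌝ : ∀ k → 1 ℕ.≤ k → 0ℚ < ⌜ k ⌝
  0<⌜ k ⌝ 1≤k = <-≤-trans (*<* (ℤ.+<+ (ℕ.s≤s ℕ.z≤n))) (ℕ→ℚ-mono {1} {k} 1≤k)

  *-monoʳ-≤′ : ∀ {x y} c → 0ℚ ≤ c → x ≤ y → x * c ≤ y * c
  *-monoʳ-≤′ c 0≤c x≤y = *-monoʳ-≤-nonNeg c {{nonNegative 0≤c}} x≤y

  *-monoˡ-≤′ : ∀ {x y} c → 0ℚ ≤ c → x ≤ y → c * x ≤ c * y
  *-monoˡ-≤′ c 0≤c x≤y = *-monoˡ-≤-nonNeg c {{nonNegative 0≤c}} x≤y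

  *-mono-≤′ : ∀ {x y u v} → 0ℚ ≤ x → x ≤ y → 0ℚ ≤ u → u ≤ v → x * u ≤ y * v
  *-mono-≤′ {x} {v = v} 0≤x x≤y 0≤u u≤v = ≤-trans (*-monoˡ-≤′ x 0≤x u≤v) (*-monoʳ-≤′ v (≤-trans 0≤u u≤v) x≤y)

  *-cancelʳ-≤′ : ∀ {x y} c → 0ℚ < c → x * c ≤ y * c → x ≤ y
  *-cancelʳ-≤′ c 0<c = *-cancelʳ-≤-pos c {{positive 0<c}}

  +-cancelʳ-≤′ : ∀ {x y} z → x + z ≤ y + z → x ≤ y
  +-cancelʳ-≤′ {x} {y} z x+z≤y+z = subst₂ _≤_ (cancel x z) (cancel y z) (+-monoˡ-≤ (- z) x+z≤y+z)
    where
    cancel : ∀ x z → x + z + - z ≡ x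
    cancel = solve 2 (λ x z → x :+ z :+ (:- z) := x) refl

  0≤* : ∀ {x y} → 0ℚ ≤ x → 0ℚ ≤ y → 0ℚ ≤ x * y
  0≤* {y = y} 0≤x 0≤y = ≤-trans (≤-reflexive (sym (*-zeroˡ y))) (*-monoʳ-≤′ y 0≤y 0≤x)

  0<* : ∀ {x y} → 0ℚ < x → 0ℚ < y → 0ℚ < x * y
  0<* {x} {y} 0<x 0<y = positive⁻¹ (x * y) {{pos*pos⇒pos x {{positive 0<x}} y {{positive 0<y}}}}

  ≤-+-nonNeg : ∀ {x y} z → 0ℚ ≤ z → x + z ≡ y → x ≤ y
  ≤-+-nonNeg {x} z 0≤z x+z≡y = ≤-trans (≤-reflexive (sym (+-identityʳ x))) (≤-trans (+-monoʳ-≤ x 0≤z) (≤-reflexive x+z≡y))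

  0≤1/ : ∀ δ (0<δ : 0ℚ < δ) → 0ℚ ≤ (1/ δ) {{>-nonZero 0<δ}}
  0≤1/ δ 0<δ = <⇒≤ (positive⁻¹ ((1/ δ) {{>-nonZero 0<δ}}) {{1/pos⇒pos δ {{positive 0<δ}}}})

  module _ where
    open ≤-Reasoning

    4P≤a² : ∀ {A K δ ε n a P} → 0ℚ ≤ A → 0ℚ ≤ δ → 0ℚ ≤ n → 0ℚ ≤ K →
      P ≤ ⌜ 2 ⌝ * A * ε * (n * n) → ε ≤ δ * δ → ⌜ 8 ⌝ * A ≤ K * K → K * δ * n ≤ a → ⌜ 4 ⌝ * P ≤ a * a
    4P≤a² {A} {K} {δ} {ε} {n} {a} {P} 0≤A 0≤δ 0≤n 0≤K P≤ ε≤δ² 8A≤K² Kδn≤a = begin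
      ⌜ 4 ⌝ * P                                 ≤⟨ *-monoˡ-≤′ ⌜ 4 ⌝ (0≤⌜ 4 ⌝) (≤-trans P≤ (*-monoʳ-≤′ (n * n) (0≤* 0≤n 0≤n)
                                                     (*-monoˡ-≤′ (⌜ 2 ⌝ * A) (0≤* (0≤⌜ 2 ⌝) 0≤A) ε≤δ²))) ⟩
      ⌜ 4 ⌝ * (⌜ 2 ⌝ * A * (δ * δ) * (n * n))   ≡⟨ regroup A δ n ⟩
      (⌜ 8 ⌝ * A) * ((δ * n) * (δ * n))         ≤⟨ *-monoʳ-≤′ ((δ * n) * (δ * n)) (0≤* 0≤δn 0≤δn) 8A≤K² ⟩
      (K * K) * ((δ * n) * (δ * n))             ≡⟨ square K δ n ⟩
      (K * δ * n) * (K * δ * n)                 ≤⟨ *-mono-≤′ 0≤Kδn Kδn≤a 0≤Kδn Kδn≤a ⟩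
      a * a                                     ∎
      where
      0≤δn : 0ℚ ≤ δ * n
      0≤δn = 0≤* 0≤δ 0≤n
      0≤Kδn : 0ℚ ≤ K * δ * n
      0≤Kδn = 0≤* (0≤* 0≤K 0≤δ) 0≤n
      regroup : ∀ A δ n → ⌜ 4 ⌝ * (⌜ 2 ⌝ * A * (δ * δ) * (n * n)) ≡ (⌜ 8 ⌝ * A) * ((δ * n) * (δ * n))
      regroup = solve 3 (λ A δ n → con ⌜ 4 ⌝ :* (con ⌜ 2 ⌝ :* A :* (δ :* δ) :* (n :* n)) := (con ⌜ 8 ⌝ :* A) :* ((δ :* n) :* (δ :* n))) refl
      square : ∀ K δ n → (K * K) * ((δ * n) * (δ * n)) ≡ (K * δ * n) * (K * δ * n)
      square = solve 3 (λ K δ n → (K :* K) :* ((δ :* n) :* (δ :* n)) := (K :* δ :* n) :* (K :* δ :* n)) refl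

    line-large : ∀ {a m P} → 0ℚ < a → a * a + a ≤ P + ⌜ 2 ⌝ * a * m → ⌜ 4 ⌝ * P ≤ a * a → ⌜ 3 ⌝ * a + ⌜ 4 ⌝ ≤ ⌜ 8 ⌝ * m
    line-large {a} {m} {P} 0<a a²+a≤ 4P≤a² = *-cancelʳ-≤′ a 0<a (+-cancelʳ-≤′ (a * a) (begin
      (⌜ 3 ⌝ * a + ⌜ 4 ⌝) * a + a * a ≡⟨ expand a ⟩
      ⌜ 4 ⌝ * (a * a + a)             ≤⟨ *-monoˡ-≤′ ⌜ 4 ⌝ (0≤⌜ 4 ⌝) a²+a≤ ⟩
      ⌜ 4 ⌝ * (P + ⌜ 2 ⌝ * a * m)     ≡⟨ distribute P a m ⟩
      ⌜ 4 ⌝ * P + ⌜ 8 ⌝ * m * a       ≤⟨ +-monoˡ-≤ (⌜ 8 ⌝ * m * a) 4P≤a² ⟩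
      a * a + ⌜ 8 ⌝ * m * a           ≡⟨ +-comm (a * a) _ ⟩
      ⌜ 8 ⌝ * m * a + a * a           ∎))
      where
      expand : ∀ a → (⌜ 3 ⌝ * a + ⌜ 4 ⌝) * a + a * a ≡ ⌜ 4 ⌝ * (a * a + a)
      expand = solve 1 (λ a → (con ⌜ 3 ⌝ :* a :+ con ⌜ 4 ⌝) :* a :+ a :* a := con ⌜ 4 ⌝ :* (a :* a :+ a)) refl
      distribute : ∀ P a m → ⌜ 4 ⌝ * (P + ⌜ 2 ⌝ * a * m) ≡ ⌜ 4 ⌝ * P + ⌜ 8 ⌝ * m * a
      distribute = solve 3 (λ P a m → con ⌜ 4 ⌝ :* (P :+ con ⌜ 2 ⌝ :* a :* m) := con ⌜ 4 ⌝ :* P :+ con ⌜ 8 ⌝ :* m :* a) refl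

    -- With at least one cell off the line, 3a + 4 ≤ 8m forces a ≥ 12/5, hence m − 1 ≥ a/6.
    line-excess : ∀ {a m} → ⌜ 3 ⌝ * a + ⌜ 4 ⌝ ≤ ⌜ 8 ⌝ * m → m + ⌜ 1 ⌝ ≤ a → ⌜ 8 ⌝ * a + ⌜ 48 ⌝ ≤ ⌜ 48 ⌝ * m
    line-excess {a} {m} 3a+4≤8m m+1≤a = begin
      ⌜ 8 ⌝ * a + ⌜ 48 ⌝                                         ≡⟨ split a ⟩
      ⌜ 2 ⌝ * (⌜ 12 ⌝ + (⌜ 3 ⌝ * a + ⌜ 4 ⌝)) + (⌜ 2 ⌝ * a + ⌜ 16 ⌝) ≤⟨ +-monoˡ-≤ _ (*-monoˡ-≤′ ⌜ 2 ⌝ (0≤⌜ 2 ⌝) 12+3a+4≤8a+4) ⟩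
      ⌜ 2 ⌝ * (⌜ 8 ⌝ * a + ⌜ 4 ⌝) + (⌜ 2 ⌝ * a + ⌜ 16 ⌝)          ≡⟨ merge a ⟩
      ⌜ 6 ⌝ * (⌜ 3 ⌝ * a + ⌜ 4 ⌝)                                ≤⟨ *-monoˡ-≤′ ⌜ 6 ⌝ (0≤⌜ 6 ⌝) 3a+4≤8m ⟩
      ⌜ 6 ⌝ * (⌜ 8 ⌝ * m)                                        ≡⟨ times m ⟩
      ⌜ 48 ⌝ * m                                                 ∎
      where
      12+3a+4≤8a+4 : ⌜ 12 ⌝ + (⌜ 3 ⌝ * a + ⌜ 4 ⌝) ≤ ⌜ 8 ⌝ * a + ⌜ 4 ⌝
      12+3a+4≤8a+4 = begin
        ⌜ 12 ⌝ + (⌜ 3 ⌝ * a + ⌜ 4 ⌝) ≤⟨ +-monoʳ-≤ ⌜ 12 ⌝ 3a+4≤8m ⟩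
        ⌜ 12 ⌝ + ⌜ 8 ⌝ * m           ≡⟨ shift m ⟩
        ⌜ 8 ⌝ * (m + ⌜ 1 ⌝) + ⌜ 4 ⌝  ≤⟨ +-monoˡ-≤ ⌜ 4 ⌝ (*-monoˡ-≤′ ⌜ 8 ⌝ (0≤⌜ 8 ⌝) m+1≤a) ⟩
        ⌜ 8 ⌝ * a + ⌜ 4 ⌝            ∎
        where
        shift : ∀ m → ⌜ 12 ⌝ + ⌜ 8 ⌝ * m ≡ ⌜ 8 ⌝ * (m + ⌜ 1 ⌝) + ⌜ 4 ⌝
        shift = solve 1 (λ m → con ⌜ 12 ⌝ :+ con ⌜ 8 ⌝ :* m := con ⌜ 8 ⌝ :* (m :+ con ⌜ 1 ⌝) :+ con ⌜ 4 ⌝) refl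
      split : ∀ a → ⌜ 8 ⌝ * a + ⌜ 48 ⌝ ≡ ⌜ 2 ⌝ * (⌜ 12 ⌝ + (⌜ 3 ⌝ * a + ⌜ 4 ⌝)) + (⌜ 2 ⌝ * a + ⌜ 16 ⌝)
      split = solve 1 (λ a → con ⌜ 8 ⌝ :* a :+ con ⌜ 48 ⌝
                           := con ⌜ 2 ⌝ :* (con ⌜ 12 ⌝ :+ (con ⌜ 3 ⌝ :* a :+ con ⌜ 4 ⌝)) :+ (con ⌜ 2 ⌝ :* a :+ con ⌜ 16 ⌝)) refl
      merge : ∀ a → ⌜ 2 ⌝ * (⌜ 8 ⌝ * a + ⌜ 4 ⌝) + (⌜ 2 ⌝ * a + ⌜ 16 ⌝) ≡ ⌜ 6 ⌝ * (⌜ 3 ⌝ * a + ⌜ 4 ⌝)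
      merge = solve 1 (λ a → con ⌜ 2 ⌝ :* (con ⌜ 8 ⌝ :* a :+ con ⌜ 4 ⌝) :+ (con ⌜ 2 ⌝ :* a :+ con ⌜ 16 ⌝)
                           := con ⌜ 6 ⌝ :* (con ⌜ 3 ⌝ :* a :+ con ⌜ 4 ⌝)) refl
      times : ∀ m → ⌜ 6 ⌝ * (⌜ 8 ⌝ * m) ≡ ⌜ 48 ⌝ * m
      times = solve 1 (λ m → con ⌜ 6 ⌝ :* (con ⌜ 8 ⌝ :* m) := con ⌜ 48 ⌝ :* m) refl

    off-line*card≤6P : ∀ {a m r P} → 0ℚ ≤ r → r * m ≤ P + r → ⌜ 8 ⌝ * a + ⌜ 48 ⌝ ≤ ⌜ 48 ⌝ * m → r * a ≤ ⌜ 6 ⌝ * P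
    off-line*card≤6P {a} {m} {r} {P} 0≤r rm≤P+r 8a+48≤48m = *-cancelʳ-≤′ ⌜ 8 ⌝ (0<⌜ 8 ⌝ (ℕ.s≤s ℕ.z≤n)) (+-cancelʳ-≤′ (⌜ 48 ⌝ * r) (begin
      r * a * ⌜ 8 ⌝ + ⌜ 48 ⌝ * r  ≡⟨ factor r a ⟩
      r * (⌜ 8 ⌝ * a + ⌜ 48 ⌝)    ≤⟨ *-monoˡ-≤′ r 0≤r 8a+48≤48m ⟩
      r * (⌜ 48 ⌝ * m)            ≡⟨ commute r m ⟩
      ⌜ 48 ⌝ * (r * m)            ≤⟨ *-monoˡ-≤′ ⌜ 48 ⌝ (0≤⌜ 48 ⌝) rm≤P+r ⟩
      ⌜ 48 ⌝ * (P + r)            ≡⟨ distribute P r ⟩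
      ⌜ 6 ⌝ * P * ⌜ 8 ⌝ + ⌜ 48 ⌝ * r ∎))
      where
      factor : ∀ r a → r * a * ⌜ 8 ⌝ + ⌜ 48 ⌝ * r ≡ r * (⌜ 8 ⌝ * a + ⌜ 48 ⌝)
      factor = solve 2 (λ r a → r :* a :* con ⌜ 8 ⌝ :+ con ⌜ 48 ⌝ :* r := r :* (con ⌜ 8 ⌝ :* a :+ con ⌜ 48 ⌝)) refl
      commute : ∀ r m → r * (⌜ 48 ⌝ * m) ≡ ⌜ 48 ⌝ * (r * m)
      commute = solve 2 (λ r m → r :* (con ⌜ 48 ⌝ :* m) := con ⌜ 48 ⌝ :* (r :* m)) refl
      distribute : ∀ P r → ⌜ 48 ⌝ * (P + r) ≡ ⌜ 6 ⌝ * P * ⌜ 8 ⌝ + ⌜ 48 ⌝ * r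
      distribute = solve 2 (λ P r → con ⌜ 48 ⌝ :* (P :+ r) := con ⌜ 6 ⌝ :* P :* con ⌜ 8 ⌝ :+ con ⌜ 48 ⌝ :* r) refl

    off-line-mass-bound : ∀ {A K δ ε n a r P} → 0ℚ ≤ ε → 0ℚ < n → 0ℚ < K → 0ℚ ≤ r →
      r * a ≤ ⌜ 6 ⌝ * P → P ≤ ⌜ 2 ⌝ * A * ε * (n * n) → ⌜ 12 ⌝ * A ≤ K → K * δ * n ≤ a → r * δ ≤ ε * n
    off-line-mass-bound {A} {K} {δ} {ε} {n} {a} {r} {P} 0≤ε 0<n 0<K 0≤r ra≤6P P≤ 12A≤K Kδn≤a =
      *-cancelʳ-≤′ (K * n) (0<* 0<K 0<n) (begin
      r * δ * (K * n)                   ≡⟨ regroup r δ K n ⟩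
      r * (K * δ * n)                   ≤⟨ *-monoˡ-≤′ r 0≤r Kδn≤a ⟩
      r * a                             ≤⟨ ra≤6P ⟩
      ⌜ 6 ⌝ * P                         ≤⟨ *-monoˡ-≤′ ⌜ 6 ⌝ (0≤⌜ 6 ⌝) P≤ ⟩
      ⌜ 6 ⌝ * (⌜ 2 ⌝ * A * ε * (n * n)) ≡⟨ collect A ε n ⟩
      (⌜ 12 ⌝ * A) * (ε * n * n)        ≤⟨ *-monoʳ-≤′ (ε * n * n) (0≤* (0≤* 0≤ε (<⇒≤ 0<n)) (<⇒≤ 0<n)) 12A≤K ⟩
      K * (ε * n * n)                   ≡⟨ commute K ε n ⟩
      ε * n * (K * n)                   ∎)
      where
      regroup : ∀ r δ K n → r * δ * (K * n) ≡ r * (K * δ * n)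
      regroup = solve 4 (λ r δ K n → r :* δ :* (K :* n) := r :* (K :* δ :* n)) refl
      collect : ∀ A ε n → ⌜ 6 ⌝ * (⌜ 2 ⌝ * A * ε * (n * n)) ≡ (⌜ 12 ⌝ * A) * (ε * n * n)
      collect = solve 3 (λ A ε n → con ⌜ 6 ⌝ :* (con ⌜ 2 ⌝ :* A :* ε :* (n :* n)) := (con ⌜ 12 ⌝ :* A) :* (ε :* n :* n)) refl
      commute : ∀ K ε n → K * (ε * n * n) ≡ ε * n * (K * n)
      commute = solve 3 (λ K ε n → K :* (ε :* n :* n) := ε :* n :* (K :* n)) refl

  module Constants (A : ℚ) (0<A : 0ℚ < A) where

    -- K is what the heavy-line argument needs (8A ≤ K², 12A ≤ K, A ≤ K); B also absorbs the
    -- constants of the two second-moment bounds.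
    K : ℚ
    K = ⌜ 12 ⌝ * A + ⌜ 12 ⌝

    B : ℚ
    B = K + ⌜ 4 ⌝ * A + ⌜ 2 ⌝ * (A * A) + ⌜ 1 ⌝

    private
      0≤A : 0ℚ ≤ A
      0≤A = <⇒≤ 0<A
      0≤A² : 0ℚ ≤ A * A
      0≤A² = 0≤* 0≤A 0≤A

    0<K : 0ℚ < K
    0<K = <-≤-trans (0<⌜ 12 ⌝ (ℕ.s≤s ℕ.z≤n)) (≤-+-nonNeg (⌜ 12 ⌝ * A) (0≤* (0≤⌜ 12 ⌝) 0≤A) (+-comm ⌜ 12 ⌝ (⌜ 12 ⌝ * A)))

    8A≤K² : ⌜ 8 ⌝ * A ≤ K * K
    8A≤K² = ≤-+-nonNeg (⌜ 144 ⌝ * (A * A) + ⌜ 280 ⌝ * A + ⌜ 144 ⌝)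
      (+-mono-≤ (+-mono-≤ (0≤* (0≤⌜ 144 ⌝) 0≤A²) (0≤* (0≤⌜ 280 ⌝) 0≤A)) (0≤⌜ 144 ⌝))
      (solve 1 (λ A → con ⌜ 8 ⌝ :* A :+ (con ⌜ 144 ⌝ :* (A :* A) :+ con ⌜ 280 ⌝ :* A :+ con ⌜ 144 ⌝)
                    := (con ⌜ 12 ⌝ :* A :+ con ⌜ 12 ⌝) :* (con ⌜ 12 ⌝ :* A :+ con ⌜ 12 ⌝)) refl A)

    12A≤K : ⌜ 12 ⌝ * A ≤ K
    12A≤K = ≤-+-nonNeg ⌜ 12 ⌝ (0≤⌜ 12 ⌝) refl

    A≤K : A ≤ K
    A≤K = ≤-+-nonNeg (⌜ 11 ⌝ * A + ⌜ 12 ⌝) (+-mono-≤ (0≤* (0≤⌜ 11 ⌝) 0≤A) (0≤⌜ 12 ⌝))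
      (solve 1 (λ A → A :+ (con ⌜ 11 ⌝ :* A :+ con ⌜ 12 ⌝) := con ⌜ 12 ⌝ :* A :+ con ⌜ 12 ⌝) refl A)

    K+4A+2A²≤B : K + ⌜ 4 ⌝ * A + ⌜ 2 ⌝ * (A * A) ≤ B
    K+4A+2A²≤B = ≤-+-nonNeg ⌜ 1 ⌝ (0≤⌜ 1 ⌝) refl

    1+4A≤B : ⌜ 1 ⌝ + ⌜ 4 ⌝ * A ≤ B
    1+4A≤B = ≤-+-nonNeg (K + ⌜ 2 ⌝ * (A * A)) (+-mono-≤ (<⇒≤ 0<K) (0≤* (0≤⌜ 2 ⌝) 0≤A²))
      (solve 2 (λ A K → con ⌜ 1 ⌝ :+ con ⌜ 4 ⌝ :* A :+ (K :+ con ⌜ 2 ⌝ :* (A :* A))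
                      := K :+ con ⌜ 4 ⌝ :* A :+ con ⌜ 2 ⌝ :* (A :* A) :+ con ⌜ 1 ⌝) refl A K)

    1≤B : ⌜ 1 ⌝ ≤ B
    1≤B = ≤-trans (≤-+-nonNeg (⌜ 4 ⌝ * A) (0≤* (0≤⌜ 4 ⌝) 0≤A) refl) 1+4A≤B

    0<B : 0ℚ < B
    0<B = <-≤-trans (0<⌜ 1 ⌝ (ℕ.s≤s ℕ.z≤n)) 1≤B

    K≤B : K ≤ B
    K≤B = ≤-trans (≤-+-nonNeg (⌜ 4 ⌝ * A + ⌜ 2 ⌝ * (A * A)) (+-mono-≤ (0≤* (0≤⌜ 4 ⌝) 0≤A) (0≤* (0≤⌜ 2 ⌝) 0≤A²))
                               (sym (+-assoc K _ _))) K+4A+2A²≤B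

  module _ where
    open ≤-Reasoning

    -- For δ ≤ 1 use P ≤ 2Aεn² ≤ 2Aδn²; for δ > 1 use P ≤ a² ≤ A²n² < A²δn².
    2P≤[4A+2A²]δn² : ∀ {A δ ε n a P Pn} → 0ℚ ≤ A → 0ℚ ≤ δ → 0ℚ ≤ n → 0ℚ ≤ a →
      a ≤ A * n → P ≤ ⌜ 2 ⌝ * Pn → Pn ≤ A * ε * (n * n) → P ≤ a * a → ε ≤ δ * δ →
      ⌜ 2 ⌝ * P ≤ (⌜ 4 ⌝ * A + ⌜ 2 ⌝ * (A * A)) * δ * (n * n)
    2P≤[4A+2A²]δn² {A} {δ} {ε} {n} {a} {P} {Pn} 0≤A 0≤δ 0≤n 0≤a a≤An P≤2Pn Pn≤ P≤a² ε≤δ² with δ ≤? ⌜ 1 ⌝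
    ... | yes δ≤1 = begin
      ⌜ 2 ⌝ * P                                                ≤⟨ *-monoˡ-≤′ ⌜ 2 ⌝ (0≤⌜ 2 ⌝) (≤-trans P≤2Pn (*-monoˡ-≤′ ⌜ 2 ⌝ (0≤⌜ 2 ⌝) Pn≤)) ⟩
      ⌜ 2 ⌝ * (⌜ 2 ⌝ * (A * ε * (n * n)))                      ≡⟨ solve 3 (λ A ε N → con ⌜ 2 ⌝ :* (con ⌜ 2 ⌝ :* (A :* ε :* N)) := con ⌜ 4 ⌝ :* A :* ε :* N) refl A ε (n * n) ⟩
      ⌜ 4 ⌝ * A * ε * (n * n)                                  ≤⟨ *-monoʳ-≤′ (n * n) 0≤n² (*-monoˡ-≤′ (⌜ 4 ⌝ * A) (0≤* (0≤⌜ 4 ⌝) 0≤A) ε≤δ) ⟩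
      ⌜ 4 ⌝ * A * δ * (n * n)                                  ≤⟨ ≤-+-nonNeg _ (0≤* (0≤* (0≤* (0≤⌜ 2 ⌝) (0≤* 0≤A 0≤A)) 0≤δ) 0≤n²) refl ⟩
      ⌜ 4 ⌝ * A * δ * (n * n) + ⌜ 2 ⌝ * (A * A) * δ * (n * n)  ≡⟨ collect A δ (n * n) ⟩
      (⌜ 4 ⌝ * A + ⌜ 2 ⌝ * (A * A)) * δ * (n * n)              ∎
      where
      0≤n² : 0ℚ ≤ n * n
      0≤n² = 0≤* 0≤n 0≤n
      ε≤δ : ε ≤ δ
      ε≤δ = ≤-trans ε≤δ² (≤-trans (*-monoˡ-≤′ δ 0≤δ δ≤1) (≤-reflexive (*-identityʳ δ)))
      collect : ∀ A δ N → ⌜ 4 ⌝ * A * δ * N + ⌜ 2 ⌝ * (A * A) * δ * N ≡ (⌜ 4 ⌝ * A + ⌜ 2 ⌝ * (A * A)) * δ * N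
      collect = solve 3 (λ A δ N → con ⌜ 4 ⌝ :* A :* δ :* N :+ con ⌜ 2 ⌝ :* (A :* A) :* δ :* N
                                := (con ⌜ 4 ⌝ :* A :+ con ⌜ 2 ⌝ :* (A :* A)) :* δ :* N) refl
    ... | no δ≰1 = begin
      ⌜ 2 ⌝ * P                                                ≤⟨ *-monoˡ-≤′ ⌜ 2 ⌝ (0≤⌜ 2 ⌝) (≤-trans P≤a² (*-mono-≤′ 0≤a a≤An 0≤a a≤An)) ⟩
      ⌜ 2 ⌝ * ((A * n) * (A * n))                              ≡⟨ solve 2 (λ A n → con ⌜ 2 ⌝ :* ((A :* n) :* (A :* n)) := con ⌜ 2 ⌝ :* (A :* A) :* con ⌜ 1 ⌝ :* (n :* n)) refl A n ⟩
      ⌜ 2 ⌝ * (A * A) * ⌜ 1 ⌝ * (n * n)                        ≤⟨ *-monoʳ-≤′ (n * n) 0≤n² (*-monoˡ-≤′ (⌜ 2 ⌝ * (A * A)) (0≤* (0≤⌜ 2 ⌝) (0≤* 0≤A 0≤A)) (<⇒≤ (≰⇒> δ≰1))) ⟩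
      ⌜ 2 ⌝ * (A * A) * δ * (n * n)                            ≤⟨ ≤-+-nonNeg _ (0≤* (0≤* (0≤* (0≤⌜ 4 ⌝) 0≤A) 0≤δ) 0≤n²) (+-comm _ (⌜ 4 ⌝ * A * δ * (n * n))) ⟩
      ⌜ 4 ⌝ * A * δ * (n * n) + ⌜ 2 ⌝ * (A * A) * δ * (n * n)  ≡⟨ collect A δ (n * n) ⟩
      (⌜ 4 ⌝ * A + ⌜ 2 ⌝ * (A * A)) * δ * (n * n)              ∎
      where
      0≤n² : 0ℚ ≤ n * n
      0≤n² = 0≤* 0≤n 0≤n
      collect : ∀ A δ N → ⌜ 4 ⌝ * A * δ * N + ⌜ 2 ⌝ * (A * A) * δ * N ≡ (⌜ 4 ⌝ * A + ⌜ 2 ⌝ * (A * A)) * δ * N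
      collect = solve 3 (λ A δ N → con ⌜ 4 ⌝ :* A :* δ :* N :+ con ⌜ 2 ⌝ :* (A :* A) :* δ :* N
                                := (con ⌜ 4 ⌝ :* A :+ con ⌜ 2 ⌝ :* (A :* A)) :* δ :* N) refl

    small-second-moment : ∀ {A K B δ ε n a P Pn} → 0ℚ ≤ A → 0ℚ ≤ δ → 0ℚ ≤ n → 0ℚ ≤ a →
      a ≤ K * δ * n → a ≤ A * n → P ≤ ⌜ 2 ⌝ * Pn → Pn ≤ A * ε * (n * n) → P ≤ a * a → ε ≤ δ * δ →
      K + ⌜ 4 ⌝ * A + ⌜ 2 ⌝ * (A * A) ≤ B → a * n + ⌜ 2 ⌝ * P ≤ B * δ * n * n
    small-second-moment {A} {K} {B} {δ} {ε} {n} {a} {P} 0≤A 0≤δ 0≤n 0≤a a≤Kδn a≤An P≤2Pn Pn≤ P≤a² ε≤δ² K+X≤B = begin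
      a * n + ⌜ 2 ⌝ * P                                       ≤⟨ +-mono-≤ (*-monoʳ-≤′ n 0≤n a≤Kδn)
                                                                          (2P≤[4A+2A²]δn² 0≤A 0≤δ 0≤n 0≤a a≤An P≤2Pn Pn≤ P≤a² ε≤δ²) ⟩
      K * δ * n * n + X * δ * (n * n)                         ≡⟨ solve 4 (λ K δ n X → K :* δ :* n :* n :+ X :* δ :* (n :* n) := (K :+ X) :* δ :* n :* n) refl K δ n X ⟩
      (K + X) * δ * n * n                                     ≡⟨ cong (λ z → z * δ * n * n) (+-assoc K _ _) ⟨
      (K + ⌜ 4 ⌝ * A + ⌜ 2 ⌝ * (A * A)) * δ * n * n           ≤⟨ *-monoʳ-≤′ n 0≤n (*-monoʳ-≤′ n 0≤n (*-monoʳ-≤′ δ 0≤δ K+X≤B)) ⟩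
      B * δ * n * n                                           ∎
      where
      X : ℚ
      X = ⌜ 4 ⌝ * A + ⌜ 2 ⌝ * (A * A)

    δ≤1 : ∀ {A K δ n a} → 0ℚ < n → 0ℚ < K → K * δ * n < a → a ≤ A * n → A ≤ K → δ ≤ ⌜ 1 ⌝
    δ≤1 {A} {K} {δ} {n} {a} 0<n 0<K Kδn<a a≤An A≤K = *-cancelʳ-≤′ (K * n) (0<* 0<K 0<n) (begin
      δ * (K * n)       ≡⟨ solve 3 (λ δ K n → δ :* (K :* n) := K :* δ :* n) refl δ K n ⟩
      K * δ * n         ≤⟨ <⇒≤ Kδn<a ⟩
      a                 ≤⟨ a≤An ⟩
      A * n             ≤⟨ *-monoʳ-≤′ n (<⇒≤ 0<n) A≤K ⟩
      K * n             ≡⟨ *-identityˡ (K * n) ⟨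
      ⌜ 1 ⌝ * (K * n)   ∎)

    1≤1/ : ∀ δ (0<δ : 0ℚ < δ) → δ ≤ ⌜ 1 ⌝ → ⌜ 1 ⌝ ≤ (1/ δ) {{>-nonZero 0<δ}}
    1≤1/ δ 0<δ δ≤1 = begin
      ⌜ 1 ⌝                            ≡⟨ *-inverseʳ δ {{>-nonZero 0<δ}} ⟨
      δ * (1/ δ) {{>-nonZero 0<δ}}      ≤⟨ *-monoʳ-≤′ _ (0≤1/ δ 0<δ) δ≤1 ⟩
      ⌜ 1 ⌝ * (1/ δ) {{>-nonZero 0<δ}}  ≡⟨ *-identityˡ _ ⟩
      (1/ δ) {{>-nonZero 0<δ}}          ∎

    divide-by-δ : ∀ δ (0<δ : 0ℚ < δ) {ε n r} → r * δ ≤ ε * n → r ≤ ε * (1/ δ) {{>-nonZero 0<δ}} * n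
    divide-by-δ δ 0<δ {ε} {n} {r} rδ≤εn = begin
      r                   ≡⟨ *-identityʳ r ⟨
      r * ⌜ 1 ⌝           ≡⟨ cong (r *_) (*-inverseʳ δ {{>-nonZero 0<δ}}) ⟨
      r * (δ * δ⁻¹)       ≡⟨ *-assoc r δ δ⁻¹ ⟨
      r * δ * δ⁻¹         ≤⟨ *-monoʳ-≤′ δ⁻¹ (0≤1/ δ 0<δ) rδ≤εn ⟩
      ε * n * δ⁻¹         ≡⟨ solve 3 (λ ε n i → ε :* n :* i := ε :* i :* n) refl ε n δ⁻¹ ⟩
      ε * δ⁻¹ * n         ∎
      where
      δ⁻¹ : ℚ
      δ⁻¹ = (1/ δ) {{>-nonZero 0<δ}}

    large-second-moment : ∀ {A B δ} (0<δ : 0ℚ < δ) {ε n r P Pn} → 0ℚ ≤ A → 0ℚ ≤ ε → 0ℚ ≤ n →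
      r ≤ ε * (1/ δ) {{>-nonZero 0<δ}} * n → δ ≤ ⌜ 1 ⌝ → P ≤ ⌜ 2 ⌝ * Pn → Pn ≤ A * ε * (n * n) → ⌜ 1 ⌝ + ⌜ 4 ⌝ * A ≤ B →
      r * n + ⌜ 2 ⌝ * P ≤ B * ε * (1/ δ) {{>-nonZero 0<δ}} * n * n
    large-second-moment {A} {B} {δ} 0<δ {ε} {n} {r} {P} 0≤A 0≤ε 0≤n r≤ δ≤1 P≤2Pn Pn≤ 1+4A≤B = begin
      r * n + ⌜ 2 ⌝ * P                                 ≤⟨ +-mono-≤ (*-monoʳ-≤′ n 0≤n r≤) (*-monoˡ-≤′ ⌜ 2 ⌝ (0≤⌜ 2 ⌝) (≤-trans P≤2Pn (*-monoˡ-≤′ ⌜ 2 ⌝ (0≤⌜ 2 ⌝) Pn≤))) ⟩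
      ε * δ⁻¹ * n * n + ⌜ 2 ⌝ * (⌜ 2 ⌝ * (A * ε * (n * n))) ≡⟨ regroup ε δ⁻¹ n A (n * n) ⟩
      ε * δ⁻¹ * n * n + ⌜ 4 ⌝ * A * ε * (n * n) * ⌜ 1 ⌝   ≤⟨ +-monoʳ-≤ (ε * δ⁻¹ * n * n) (*-monoˡ-≤′ (⌜ 4 ⌝ * A * ε * (n * n))
                                                             (0≤* (0≤* (0≤* (0≤⌜ 4 ⌝) 0≤A) 0≤ε) (0≤* 0≤n 0≤n)) (1≤1/ δ 0<δ δ≤1)) ⟩
      ε * δ⁻¹ * n * n + ⌜ 4 ⌝ * A * ε * (n * n) * δ⁻¹    ≡⟨ collect ε δ⁻¹ n A ⟩
      (⌜ 1 ⌝ + ⌜ 4 ⌝ * A) * ε * δ⁻¹ * n * n             ≤⟨ *-monoʳ-≤′ n 0≤n (*-monoʳ-≤′ n 0≤n (*-monoʳ-≤′ δ⁻¹ (0≤1/ δ 0<δ) (*-monoʳ-≤′ ε 0≤ε 1+4A≤B))) ⟩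
      B * ε * δ⁻¹ * n * n                               ∎
      where
      δ⁻¹ : ℚ
      δ⁻¹ = (1/ δ) {{>-nonZero 0<δ}}
      regroup : ∀ ε i n A N → ε * i * n * n + ⌜ 2 ⌝ * (⌜ 2 ⌝ * (A * ε * N)) ≡ ε * i * n * n + ⌜ 4 ⌝ * A * ε * N * ⌜ 1 ⌝
      regroup = solve 5 (λ ε i n A N → ε :* i :* n :* n :+ con ⌜ 2 ⌝ :* (con ⌜ 2 ⌝ :* (A :* ε :* N))
                                     := ε :* i :* n :* n :+ con ⌜ 4 ⌝ :* A :* ε :* N :* con ⌜ 1 ⌝) refl
      collect : ∀ ε i n A → ε * i * n * n + ⌜ 4 ⌝ * A * ε * (n * n) * i ≡ (⌜ 1 ⌝ + ⌜ 4 ⌝ * A) * ε * i * n * n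
      collect = solve 4 (λ ε i n A → ε :* i :* n :* n :+ con ⌜ 4 ⌝ :* A :* ε :* (n :* n) :* i
                                   := (con ⌜ 1 ⌝ :+ con ⌜ 4 ⌝ :* A) :* ε :* i :* n :* n) refl

    bound-from-first-moment : ∀ {t a s N n X} → 0ℚ < n → t * n ≡ a * s → s ≤ N → 0ℚ ≤ a → a ≤ X * n → 0ℚ ≤ N → t ≤ X * N
    bound-from-first-moment {t} {a} {s} {N} {n} {X} 0<n tn≡as s≤N 0≤a a≤Xn 0≤N = *-cancelʳ-≤′ n 0<n (begin
      t * n      ≡⟨ tn≡as ⟩
      a * s      ≤⟨ *-monoˡ-≤′ a 0≤a s≤N ⟩
      a * N      ≤⟨ *-monoʳ-≤′ N 0≤N a≤Xn ⟩
      X * n * N  ≡⟨ solve 3 (λ X n N → X :* n :* N := X :* N :* n) refl X n N ⟩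
      X * N * n  ∎)

    bound-from-second-moment : ∀ {t a s N n P Y} → 0ℚ < n → t * n * n ≤ a * (s * n) + P * (⌜ 2 ⌝ * s) → s ≤ N →
      0ℚ ≤ a → 0ℚ ≤ P → a * n + ⌜ 2 ⌝ * P ≤ Y * n * n → 0ℚ ≤ N → t ≤ Y * N
    bound-from-second-moment {t} {a} {s} {N} {n} {P} {Y} 0<n t≤ s≤N 0≤a 0≤P an+2P≤ 0≤N = *-cancelʳ-≤′ (n * n) (0<* 0<n 0<n) (begin
      t * (n * n)                      ≡⟨ *-assoc t n n ⟨
      t * n * n                        ≤⟨ t≤ ⟩
      a * (s * n) + P * (⌜ 2 ⌝ * s)    ≡⟨ solve 4 (λ a s n P → a :* (s :* n) :+ P :* (con ⌜ 2 ⌝ :* s) := (a :* n :+ con ⌜ 2 ⌝ :* P) :* s) refl a s n P ⟩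
      (a * n + ⌜ 2 ⌝ * P) * s          ≤⟨ *-monoˡ-≤′ (a * n + ⌜ 2 ⌝ * P) (+-mono-≤ (0≤* 0≤a (<⇒≤ 0<n)) (0≤* (0≤⌜ 2 ⌝) 0≤P)) s≤N ⟩
      (a * n + ⌜ 2 ⌝ * P) * N          ≤⟨ *-monoʳ-≤′ N 0≤N an+2P≤ ⟩
      Y * n * n * N                    ≡⟨ solve 3 (λ Y n N → Y :* n :* n :* N := Y :* N :* (n :* n)) refl Y n N ⟩
      Y * N * (n * n)                  ∎)

open import Data.Bool using (Bool; true; false; not; if_then_else_)
open import Data.Nat as ℕ using (ℕ; zero; suc; _≡ᵇ_; _!)
import Data.Nat.Properties as ℕ
open import Data.Fin using (Fin; fromℕ<)
open import Data.List using (List; []; _∷_)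
open import Data.Vec using (lookup)
open import Data.Product using (_×_; _,_; Σ)
open import Data.Sum as Sum using (_⊎_)
import Data.Integer as ℤ
open import Data.Rational using (ℚ; 0ℚ; 1ℚ; _+_; _*_; _-_; _≤_; _<_; _/_; 1/_; >-nonZero)
open import Data.Rational.Properties using (≤-trans; ≤-<-trans; ≤-reflexive; <⇒≤; ≰⇒>; _≤?_; +-monoʳ-≤; *-assoc; *-comm; *-identityˡ; *-identityʳ; normalize-nonNeg; nonNegative⁻¹; module ≤-Reasoning)
open import Data.Rational.Solver using (module +-*-Solver)
open +-*-Solver using (solve; _:=_; _:+_; _:*_; _:-_; con)
open import Relation.Nullary using (¬_)
open import Relation.Nullary.Decidable using (toSum)
open import Relation.Binary.PropositionalEquality using (_≡_; refl; sym; trans; cong; cong₂; subst; subst₂)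
open import Function using (_∘_)

open Counting
open Arithmetic

1/n! : ℕ → ℚ
1/n! n = ((ℤ.+ 1) / (n !)) {{n ℕ.!≢0}}

∑ℚ-ℕ→ℚ : ∀ {A : Set} (xs : List A) (f : A → ℕ) → sumℚ xs (ℕ→ℚ ∘ f) ≡ ℕ→ℚ (∑ xs f)
∑ℚ-ℕ→ℚ [] f = refl
∑ℚ-ℕ→ℚ (x ∷ xs) f = trans (cong (ℕ→ℚ (f x) +_) (∑ℚ-ℕ→ℚ xs f)) (sym (ℕ→ℚ-+ (f x) _))

sumℚ-cong : ∀ {A : Set} (xs : List A) {f g : A → ℚ} → (∀ x → f x ≡ g x) → sumℚ xs f ≡ sumℚ xs g
sumℚ-cong [] f≗g = refl
sumℚ-cong (x ∷ xs) f≗g = cong₂ _+_ (f≗g x) (sumℚ-cong xs f≗g)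

𝔼-cong : ∀ n {f g : (Fin n → Fin n) → ℚ} → (∀ π → f π ≡ g π) → 𝔼 n f ≡ 𝔼 n g
𝔼-cong n f≗g = cong (_* 1/n! n) (sumℚ-cong (Sym n) f≗g)

𝔼-ℕ≡∑Perm : ∀ n (f : (Fin n → Fin n) → ℕ) → 𝔼 n (ℕ→ℚ ∘ f) ≡ ℕ→ℚ (∑Perm n (f ∘ lookup)) * 1/n! n
𝔼-ℕ≡∑Perm n f = cong (_* 1/n! n) (trans (∑ℚ-ℕ→ℚ (Sym n) f) (cong ℕ→ℚ (∑-Sym≡∑Perm n f)))

Pr≡∑Perm : ∀ n (P : (Fin n → Fin n) → Bool) → Pr n P ≡ ℕ→ℚ (∑Perm n (λ v → 𝟙 (P (lookup v)))) * 1/n! n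
Pr≡∑Perm n P = trans (𝔼-cong n indicator) (𝔼-ℕ≡∑Perm n (𝟙 ∘ P))
  where
  indicator : ∀ π → (if P π then 1ℚ else 0ℚ) ≡ ℕ→ℚ (𝟙 (P π))
  indicator π with P π
  ... | true = refl
  ... | false = refl

scale-by-1/n! : ∀ n {x Y} → x ≤ Y * ℕ→ℚ (n !) → x * 1/n! n ≤ Y
scale-by-1/n! n {x} {Y} x≤Yn! = begin
  x * 1/n! n                    ≤⟨ *-monoʳ-≤′ (1/n! n) 0≤1/n! x≤Yn! ⟩
  Y * ℕ→ℚ (n !) * 1/n! n        ≡⟨ *-assoc Y _ _ ⟩
  Y * (ℕ→ℚ (n !) * 1/n! n)      ≡⟨ cong (Y *_) (trans (*-comm _ (1/n! n)) (1/N*N≡1 (n !) {{n ℕ.!≢0}})) ⟩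
  Y * 1ℚ                        ≡⟨ *-identityʳ Y ⟩
  Y                             ∎
  where
  open ≤-Reasoning
  0≤1/n! : 0ℚ ≤ 1/n! n
  0≤1/n! = nonNegative⁻¹ (1/n! n) {{normalize-nonNeg 1 (n !) {{n ℕ.!≢0}}}}

first-moment-cast : ∀ {n} (C : Cosets n) →
  ℕ→ℚ (∑Perm n (hᵥ C)) * ℕ→ℚ n ≡ ℕ→ℚ (card C) * ℕ→ℚ (permCount n)
first-moment-cast {n} C = trans (sym (ℕ→ℚ-* (∑Perm n (hᵥ C)) n)) (trans (cong ℕ→ℚ (first-moment C)) (ℕ→ℚ-* (card C) (permCount n)))

second-moment-cast : ∀ {n} (C : Cosets n) →
  ℕ→ℚ (∑Perm n (λ v → hᵥ C v ℕ.* hᵥ C v)) * ℕ→ℚ n * ℕ→ℚ n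
    ≤ ℕ→ℚ (card C) * (ℕ→ℚ (permCount n) * ℕ→ℚ n) + ℕ→ℚ (orderedPairs C) * (⌜ 2 ⌝ * ℕ→ℚ (permCount n))
second-moment-cast {n} C = subst₂ _≤_ lhs rhs (ℕ→ℚ-mono (second-moment-bound C))
  where
  T p : ℕ
  T = ∑Perm n (λ v → hᵥ C v ℕ.* hᵥ C v)
  p = permCount n
  lhs : ℕ→ℚ (T ℕ.* n ℕ.* n) ≡ ℕ→ℚ T * ℕ→ℚ n * ℕ→ℚ n
  lhs = trans (ℕ→ℚ-* (T ℕ.* n) n) (cong (_* ℕ→ℚ n) (ℕ→ℚ-* T n))
  rhs : ℕ→ℚ (card C ℕ.* (p ℕ.* n) ℕ.+ orderedPairs C ℕ.* (2 ℕ.* p))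
      ≡ ℕ→ℚ (card C) * (ℕ→ℚ p * ℕ→ℚ n) + ℕ→ℚ (orderedPairs C) * (⌜ 2 ⌝ * ℕ→ℚ p)
  rhs = trans (ℕ→ℚ-+ (card C ℕ.* (p ℕ.* n)) _) (cong₂ _+_
          (trans (ℕ→ℚ-* (card C) (p ℕ.* n)) (cong (ℕ→ℚ (card C) *_) (ℕ→ℚ-* p n)))
          (trans (ℕ→ℚ-* (orderedPairs C) (2 ℕ.* p)) (cong (ℕ→ℚ (orderedPairs C) *_) (ℕ→ℚ-* 2 p))))

permCount≤n!-ℚ : ∀ n → ℕ→ℚ (permCount n) ≤ ℕ→ℚ (n !)
permCount≤n!-ℚ n = ℕ→ℚ-mono (permCount≤n! n)

-- Markov's inequality in the form Pr[P] ≤ 𝔼[h] = |C|/n.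
Pr≤card/n : ∀ {n} → 1 ℕ.≤ n → (C : Cosets n) (P : (Fin n → Fin n) → Bool) {X : ℚ} →
  (∀ v → 𝟙 (P (lookup v)) ℕ.≤ hᵥ C v) → ℕ→ℚ (card C) ≤ X * ℕ→ℚ n → Pr n P ≤ X
Pr≤card/n {n} 1≤n C P {X} P≤h card≤ = ≤-trans (≤-reflexive (Pr≡∑Perm n P)) (scale-by-1/n! n
  (≤-trans (ℕ→ℚ-mono (∑Perm-mono n λ v _ → P≤h v))
    (bound-from-first-moment {X = X} (0<⌜ n ⌝ 1≤n) (first-moment-cast C) (permCount≤n!-ℚ n) (0≤⌜ card C ⌝) card≤ (0≤⌜ n ! ⌝))))

𝔼[h²]≤ : ∀ {n} → 1 ℕ.≤ n → (C : Cosets n) {Y : ℚ} →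
  ℕ→ℚ (card C) * ℕ→ℚ n + ⌜ 2 ⌝ * ℕ→ℚ (orderedPairs C) ≤ Y * ℕ→ℚ n * ℕ→ℚ n →
  𝔼 n (λ π → ℕ→ℚ (sumX C π) * ℕ→ℚ (sumX C π)) ≤ Y
𝔼[h²]≤ {n} 1≤n C {Y} bound = ≤-trans (≤-reflexive as-∑Perm) (scale-by-1/n! n {ℕ→ℚ (∑Perm n (λ v → hᵥ C v ℕ.* hᵥ C v))}
  (bound-from-second-moment {Y = Y} (0<⌜ n ⌝ 1≤n) (second-moment-cast C) (permCount≤n!-ℚ n) (0≤⌜ card C ⌝) (0≤⌜ orderedPairs C ⌝) bound (0≤⌜ n ! ⌝)))
  where
  h² : (Fin n → Fin n) → ℕ
  h² π = sumX C π ℕ.* sumX C π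
  as-∑Perm : 𝔼 n (λ π → ℕ→ℚ (sumX C π) * ℕ→ℚ (sumX C π)) ≡ ℕ→ℚ (∑Perm n (λ v → hᵥ C v ℕ.* hᵥ C v)) * 1/n! n
  as-∑Perm = trans (𝔼-cong n (λ π → sym (ℕ→ℚ-* (sumX C π) (sumX C π))))
             (trans (𝔼-ℕ≡∑Perm n h²) (cong (λ z → ℕ→ℚ z * 1/n! n) (∑Perm-cong n λ v _ → cong₂ ℕ._*_ (sumX≡hᵥ C v) (sumX≡hᵥ C v))))

𝟙[≢0]≤ : ∀ x → 𝟙 (not (x ≡ᵇ 0)) ℕ.≤ x
𝟙[≢0]≤ zero = ℕ.z≤n
𝟙[≢0]≤ (suc x) = ℕ.s≤s ℕ.z≤n

≡ᵇ-refl : ∀ x → (x ≡ᵇ x) ≡ true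
≡ᵇ-refl zero = refl
≡ᵇ-refl (suc x) = ≡ᵇ-refl x

𝟙[x+y≢x]≤y : ∀ x y → 𝟙 (not (x ℕ.+ y ≡ᵇ x)) ℕ.≤ y
𝟙[x+y≢x]≤y x zero rewrite ℕ.+-identityʳ x | ≡ᵇ-refl x = ℕ.z≤n
𝟙[x+y≢x]≤y x (suc y) with x ℕ.+ suc y ≡ᵇ x
... | true = ℕ.z≤n
... | false = ℕ.s≤s ℕ.z≤n

module _ (A : ℚ) (0<A : 0ℚ < A) where
  open Constants A 0<A

  -- Since 4P ≤ a², the heavy-line inequality puts at least 3a/8 cells on the line; the off-line
  -- inequality then gives r·a ≤ 6P ≤ 12Aεn², and a > Kδn turns this into r ≤ (ε/δ)·n.
  off-line-small : ∀ {n ε δ} (0<δ : 0ℚ < δ) → 0ℚ < ℕ→ℚ n → 0ℚ ≤ ε → ε ≤ δ * δ → (a m r P : ℕ) →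
    a ≡ m ℕ.+ r → a ℕ.* a ℕ.+ a ℕ.≤ P ℕ.+ 2 ℕ.* a ℕ.* m → r ℕ.* m ℕ.≤ P ℕ.+ r →
    ℕ→ℚ P ≤ ⌜ 2 ⌝ * A * ε * (ℕ→ℚ n * ℕ→ℚ n) → K * δ * ℕ→ℚ n < ℕ→ℚ a →
    ℕ→ℚ r ≤ ε * (1/ δ) {{>-nonZero 0<δ}} * ℕ→ℚ n
  off-line-small {n} {ε} {δ} 0<δ 0<n 0≤ε ε≤δ² a m zero P _ _ _ _ _ =
    0≤* (0≤* 0≤ε (0≤1/ δ 0<δ)) (0≤⌜ n ⌝)
  off-line-small {n} {ε} {δ} 0<δ 0<n 0≤ε ε≤δ² a m r@(suc _) P refl heavy off P≤ Kδn<a =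
    divide-by-δ δ 0<δ {ε} {ℕ→ℚ n} {ℕ→ℚ r}
      (off-line-mass-bound {A = A} {ε = ε} {n = ℕ→ℚ n} {a = ℕ→ℚ (m ℕ.+ r)} {P = ℕ→ℚ P}
        0≤ε 0<n 0<K (0≤⌜ r ⌝) ra≤6P P≤ 12A≤K (<⇒≤ Kδn<a))
    where
    0≤δ : 0ℚ ≤ δ
    0≤δ = <⇒≤ 0<δ
    0<a : 0ℚ < ℕ→ℚ (m ℕ.+ r)
    0<a = ≤-<-trans (0≤* (0≤* (<⇒≤ 0<K) 0≤δ) (<⇒≤ 0<n)) Kδn<a
    a≡m+r : ℕ→ℚ a ≡ ℕ→ℚ m + ℕ→ℚ r
    a≡m+r = ℕ→ℚ-+ m r
    heavy-ℚ : ℕ→ℚ a * ℕ→ℚ a + ℕ→ℚ a ≤ ℕ→ℚ P + ⌜ 2 ⌝ * ℕ→ℚ a * ℕ→ℚ m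
    heavy-ℚ = subst₂ _≤_ (trans (ℕ→ℚ-+ (a ℕ.* a) a) (cong (_+ ℕ→ℚ a) (ℕ→ℚ-* a a)))
                         (trans (ℕ→ℚ-+ P (2 ℕ.* a ℕ.* m)) (cong (ℕ→ℚ P +_) (trans (ℕ→ℚ-* (2 ℕ.* a) m) (cong (_* ℕ→ℚ m) (ℕ→ℚ-* 2 a)))))
                         (ℕ→ℚ-mono heavy)
    off-ℚ : ℕ→ℚ r * ℕ→ℚ m ≤ ℕ→ℚ P + ℕ→ℚ r
    off-ℚ = subst₂ _≤_ (ℕ→ℚ-* r m) (ℕ→ℚ-+ P r) (ℕ→ℚ-mono off)
    m+1≤a : ℕ→ℚ m + ⌜ 1 ⌝ ≤ ℕ→ℚ (m ℕ.+ r)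
    m+1≤a = ≤-trans (+-monoʳ-≤ (ℕ→ℚ m) (ℕ→ℚ-mono {1} {r} (ℕ.s≤s ℕ.z≤n))) (≤-reflexive (sym a≡m+r))
    ra≤6P : ℕ→ℚ r * ℕ→ℚ (m ℕ.+ r) ≤ ⌜ 6 ⌝ * ℕ→ℚ P
    ra≤6P = off-line*card≤6P {a = ℕ→ℚ (m ℕ.+ r)} {m = ℕ→ℚ m} {P = ℕ→ℚ P} (0≤⌜ r ⌝) off-ℚ
      (line-excess {a = ℕ→ℚ (m ℕ.+ r)} {m = ℕ→ℚ m} (line-large {m = ℕ→ℚ m} {P = ℕ→ℚ P} 0<a heavy-ℚ
        (4P≤a² {A = A} {K = K} (<⇒≤ 0<A) 0≤δ (<⇒≤ 0<n) (<⇒≤ 0<K) P≤ ε≤δ² 8A≤K² (<⇒≤ Kδn<a))) m+1≤a)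

  SmallSupport : (n : ℕ) → Cosets n → ℚ → Set
  SmallSupport n C δ =
    (Pr n (λ π → not (sumX C π ≡ᵇ 0)) ≤ B * δ) × (𝔼 n (λ π → ℕ→ℚ (sumX C π) * ℕ→ℚ (sumX C π)) ≤ B * δ)

  CloseToDictator : (n : ℕ) → Cosets n → (ε δ : ℚ) → 0ℚ < δ → Set
  CloseToDictator n C ε δ 0<δ = Σ (Cosets n) λ D → IsDictator D
    × (Pr n (λ π → not (sumX C π ≡ᵇ sumX D π)) ≤ B * ε * (1/ δ) {{>-nonZero 0<δ}})
    × (𝔼 n (λ π → (ℕ→ℚ (sumX C π) - ℕ→ℚ (sumX D π)) * (ℕ→ℚ (sumX C π) - ℕ→ℚ (sumX D π)))
         ≤ B * ε * (1/ δ) {{>-nonZero 0<δ}})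

  module Cases (n : ℕ) (1≤n : 1 ℕ.≤ n) (ε : ℚ) (0≤ε : 0ℚ ≤ ε) (C : Cosets n)
               (card≤ : ℕ→ℚ (card C) ≤ A * ℕ→ℚ n) (pairs≤ : ℕ→ℚ (nonDisjointPairs C) ≤ A * ε * ℕ→ℚ (n ℕ.* n))
               (δ : ℚ) (0<δ : 0ℚ < δ) (ε≤δ² : ε ≤ δ * δ) where

    ñ : ℚ
    ñ = ℕ→ℚ n

    0<ñ : 0ℚ < ñ
    0<ñ = 0<⌜ n ⌝ 1≤n

    pairs≤Aεn² : ℕ→ℚ (nonDisjointPairs C) ≤ A * ε * (ñ * ñ)
    pairs≤Aεn² = ≤-trans pairs≤ (≤-reflexive (cong (A * ε *_) (ℕ→ℚ-* n n)))

    ordered≤2pairs : ℕ→ℚ (orderedPairs C) ≤ ⌜ 2 ⌝ * ℕ→ℚ (nonDisjointPairs C)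
    ordered≤2pairs = ≤-trans (ℕ→ℚ-mono (orderedPairs≤2*nonDisjointPairs C)) (≤-reflexive (ℕ→ℚ-* 2 (nonDisjointPairs C)))

    small : ℕ→ℚ (card C) ≤ K * δ * ñ → SmallSupport n C δ
    small card≤Kδn = Pr≤card/n 1≤n C (λ π → not (sumX C π ≡ᵇ 0))
                     (λ v → subst (𝟙 (not (sumX C (lookup v) ≡ᵇ 0)) ℕ.≤_) (sumX≡hᵥ C v) (𝟙[≢0]≤ (sumX C (lookup v)))) card≤Bδn
                   , 𝔼[h²]≤ 1≤n C (small-second-moment {K = K} {B = B} (<⇒≤ 0<A) (<⇒≤ 0<δ) (0≤⌜ n ⌝) (0≤⌜ card C ⌝)
                       card≤Kδn card≤ ordered≤2pairs pairs≤Aεn² ordered≤card² ε≤δ² K+4A+2A²≤B)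
      where
      card≤Bδn : ℕ→ℚ (card C) ≤ B * δ * ñ
      card≤Bδn = ≤-trans card≤Kδn (*-monoʳ-≤′ ñ (0≤⌜ n ⌝) (*-monoʳ-≤′ δ (<⇒≤ 0<δ) K≤B))
      ordered≤card² : ℕ→ℚ (orderedPairs C) ≤ ℕ→ℚ (card C) * ℕ→ℚ (card C)
      ordered≤card² = ≤-trans (ℕ→ℚ-mono (orderedPairs≤card² C)) (≤-reflexive (ℕ→ℚ-* (card C) (card C)))

    split : LineSplit C
    split = lineSplit C (fromℕ< 1≤n , fromℕ< 1≤n)

    L : Cell n → Bool
    L = LineSplit.line split

    D R : Cosets n
    D = C ∩ L
    R = C ∖ L

    δ⁻¹ : ℚ
    δ⁻¹ = (1/ δ) {{>-nonZero 0<δ}}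

    off-line≤εδ⁻¹n : K * δ * ñ < ℕ→ℚ (card C) → ℕ→ℚ (card R) ≤ ε * δ⁻¹ * ñ
    off-line≤εδ⁻¹n Kδn<card = off-line-small {n = n} 0<δ 0<ñ 0≤ε ε≤δ² (card C) (card D) (card R) (orderedPairs C)
      (card-split C L) (LineSplit.heavy split) (LineSplit.off-line split) ordered≤2Aεn² Kδn<card
      where
      ordered≤2Aεn² : ℕ→ℚ (orderedPairs C) ≤ ⌜ 2 ⌝ * A * ε * (ñ * ñ)
      ordered≤2Aεn² = ≤-trans ordered≤2pairs (≤-trans (*-monoˡ-≤′ ⌜ 2 ⌝ (0≤⌜ 2 ⌝) pairs≤Aεn²)
        (≤-reflexive (solve 4 (λ t A e N → t :* (A :* e :* N) := t :* A :* e :* N) refl ⌜ 2 ⌝ A ε (ñ * ñ))))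

    Pr[h≢H]≤ : K * δ * ñ < ℕ→ℚ (card C) → Pr n (λ π → not (sumX C π ≡ᵇ sumX D π)) ≤ B * ε * δ⁻¹
    Pr[h≢H]≤ Kδn<card = Pr≤card/n 1≤n R (λ π → not (sumX C π ≡ᵇ sumX D π)) differs-off-line
      (≤-trans (off-line≤εδ⁻¹n Kδn<card) (*-monoʳ-≤′ ñ (0≤⌜ n ⌝) εδ⁻¹≤Bεδ⁻¹))
      where
      differs-off-line : ∀ v → 𝟙 (not (sumX C (lookup v) ≡ᵇ sumX D (lookup v))) ℕ.≤ hᵥ R v
      differs-off-line v = subst₂ (λ s t → 𝟙 (not (s ≡ᵇ sumX D (lookup v))) ℕ.≤ t)
        (sym (sumX-split C L (lookup v))) (sumX≡hᵥ R v) (𝟙[x+y≢x]≤y (sumX D (lookup v)) (sumX R (lookup v)))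
      εδ⁻¹≤Bεδ⁻¹ : ε * δ⁻¹ ≤ B * ε * δ⁻¹
      εδ⁻¹≤Bεδ⁻¹ = ≤-trans (≤-reflexive (cong (_* δ⁻¹) (sym (*-identityˡ ε))))
                           (*-monoʳ-≤′ δ⁻¹ (0≤1/ δ 0<δ) (*-monoʳ-≤′ ε 0≤ε 1≤B))

    𝔼-square-h-H≤ : K * δ * ñ < ℕ→ℚ (card C) →
      𝔼 n (λ π → (ℕ→ℚ (sumX C π) - ℕ→ℚ (sumX D π)) * (ℕ→ℚ (sumX C π) - ℕ→ℚ (sumX D π))) ≤ B * ε * δ⁻¹
    𝔼-square-h-H≤ Kδn<card = ≤-trans (≤-reflexive (𝔼-cong n λ π → difference² {y = sumX D π} {sumX R π} (sumX-split C L π)))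
      (𝔼[h²]≤ 1≤n R (≤-trans (+-monoʳ-≤ (ℕ→ℚ (card R) * ñ) (*-monoˡ-≤′ ⌜ 2 ⌝ (0≤⌜ 2 ⌝) ordered-R≤ordered-C))
        (large-second-moment {B = B} 0<δ (<⇒≤ 0<A) 0≤ε (0≤⌜ n ⌝) (off-line≤εδ⁻¹n Kδn<card)
          (δ≤1 {A = A} {K = K} 0<ñ 0<K Kδn<card card≤ A≤K) ordered≤2pairs pairs≤Aεn² 1+4A≤B)))
      where
      ordered-R≤ordered-C : ℕ→ℚ (orderedPairs R) ≤ ℕ→ℚ (orderedPairs C)
      ordered-R≤ordered-C = ℕ→ℚ-mono (crossPairs-mono (∖-⊆ C L) (∖-⊆ C L))
      difference² : ∀ {x y z} → x ≡ y ℕ.+ z → (ℕ→ℚ x - ℕ→ℚ y) * (ℕ→ℚ x - ℕ→ℚ y) ≡ ℕ→ℚ z * ℕ→ℚ z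
      difference² {y = y} {z} refl rewrite ℕ→ℚ-+ y z =
        solve 2 (λ y z → (y :+ z :- y) :* (y :+ z :- y) := z :* z) refl (ℕ→ℚ y) (ℕ→ℚ z)

    large : ¬ (ℕ→ℚ (card C) ≤ K * δ * ñ) → CloseToDictator n C ε δ 0<δ
    large card≰Kδn = D , LineSplit.dictator split , Pr[h≢H]≤ (≰⇒> card≰Kδn) , 𝔼-square-h-H≤ (≰⇒> card≰Kδn)

lemma2p7 : (A : ℚ) → 0ℚ < A →
    Σ ℚ λ B → 0ℚ < B ×
      ((n : ℕ) → 1 ℕ.≤ n → (ε : ℚ) → 0ℚ ≤ ε → (C : Cosets n) →
        ℕ→ℚ (card C) ≤ A * ℕ→ℚ n →
        ℕ→ℚ (nonDisjointPairs C) ≤ A * ε * ℕ→ℚ (n ℕ.* n) →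
        (δ : ℚ) → (δ>0 : 0ℚ < δ) → ε ≤ δ * δ →
          ((Pr n (λ π → not (sumX C π ≡ᵇ 0)) ≤ B * δ)
            × (𝔼 n (λ π → ℕ→ℚ (sumX C π) * ℕ→ℚ (sumX C π)) ≤ B * δ))
          ⊎ (Σ (Cosets n) λ D → IsDictator D
              × (Pr n (λ π → not (sumX C π ≡ᵇ sumX D π))
                   ≤ B * ε * (1/ δ) {{>-nonZero δ>0}})
              × (𝔼 n (λ π → (ℕ→ℚ (sumX C π) - ℕ→ℚ (sumX D π))
                             * (ℕ→ℚ (sumX C π) - ℕ→ℚ (sumX D π)))
                   ≤ B * ε * (1/ δ) {{>-nonZero δ>0}})))
lemma2p7 A 0<A = B , 0<B , λ n 1≤n ε 0≤ε C card≤ pairs≤ δ 0<δ ε≤δ² →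
  let open Cases A 0<A n 1≤n ε 0≤ε C card≤ pairs≤ δ 0<δ ε≤δ²
  in Sum.map small large (toSum (ℕ→ℚ (card C) ≤? K * δ * ñ))
  where open Constants A 0<A
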